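{- For integers $n,k\ge1$ and $\alpha\ge -1$ there exists a bijection between $\mathcal{LC}_{n,k}^{(\alpha)}$ and the set $\mathcal{M}^{n-k}_{n,n+\alpha}$ of matchings with exactly $n-k$ edges of the complete bipartite graph $K_{n,n+\alpha}$ on the vertex sets $\{1,\dots,n\}$ and $\{1',\dots,(n+\alpha)'\}$.
   Context: For a finite set $A\subset\mathbb{N}$, $\mathcal{S}^{(\alpha)}[A]$ is the set of permutations of $A$ in which each cycle carries a color in $\{0,1,\dots,\alpha\}$ (for $\alpha=-1$ only $A=\emptyset$ is allowed, giving the empty permutation). A strict list is a word of integers with no repeated letter. For a finite $B\subset\mathbb N$, $\mathcal{L}in^{(k)}[B]$ is the set of sets of $k$ nonempty strict lists whose sets of letters form a partition of $B$. $\mathcal{LC}^{(\alpha)}_{n,k}$ is the set of pairs $(\sigma,\lambda)$ with $\sigma\in\mathcal{S}^{(\alpha)}[A]$, $\lambda\in\mathcal{L}in^{(k)}[B]$, where $A\cap B=\emptyset$ and $A\cup B=\{1,\dots,n\}$. A matching of a graph is a set of edges no two of which share a vertex. -}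

module Defs where

import Level
open import Data.Bool using (Bool)
open import Data.Nat using (ℕ; _+_)
open import Data.Integer as ℤ using (ℤ; +_; ∣_∣)
open import Data.Fin using (Fin)
open import Data.Fin.Subset using (Subset; _∈_; _∉_)
open import Data.Vec using (Vec; lookup)
open import Data.Maybe using (Maybe; just; nothing)
open import Data.List using (List; []; length; concat)
open import Data.List.Membership.Propositional using () renaming (_∈_ to _∈ₗ_)
open import Data.List.Relation.Unary.All using (All)
open import Data.List.Relation.Unary.AllPairs using (AllPairs)
open import Data.List.Relation.Unary.Unique.Propositional using (Unique)
open import Data.List.Relation.Binary.Permutation.Propositional using (↭-setoid)
open import Data.Product using (Σ; ∃; _×_; _,_; proj₁)
open import Data.Product.Relation.Binary.Pointwise.NonDependent using (×-setoid)
open import Relation.Binary.Bundles using (Setoid)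
open import Relation.Binary.PropositionalEquality as ≡ using (_≡_; _≢_)
import Relation.Binary.Construct.On as On
open import Function.Bundles using (_⇔_)

-- Parameters.  α : ℤ with α ≥ -1.
--   colours {0,…,α}  ↔  Fin (numColours α),   numColours α = α + 1
--   right vertex set {1',…,(n+α)'}  ↔  Fin (rightSize n α),  rightSize n α = n + α

numColours : ℤ → ℕ
numColours α = ∣ ℤ.1ℤ ℤ.+ α ∣

rightSize : ℕ → ℤ → ℕ
rightSize n α = ∣ + n ℤ.+ α ∣

-- Raw data (A , σ , col) , λ :
--   A   : Subset n                     -- the support of the coloured permutation
--   σ   : Vec (Fin n) n                -- table of σ on A, extended by the identity off A
--   col : Vec (Maybe (Fin c)) n        -- colour of the cycle containing x (nothing for x ∉ A)
--   λ   : List (List (Fin n))          -- the k strict lists (order of the lists irrelevant,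
--                                      --   see the setoid below)

LCRaw : ℕ → ℕ → Set
LCRaw n c = (Subset n × Vec (Fin n) n × Vec (Maybe (Fin c)) n) × List (List (Fin n))

record IsLC (n k c : ℕ) (r : LCRaw n c) : Set where
  constructor isLC
  field
    σ-injective  : let ((A , σ , col) , λs) = r in
                   ∀ x y → lookup σ x ≡ lookup σ y → x ≡ y
    σ-fixes-offA : let ((A , σ , col) , λs) = r in
                   ∀ x → x ∉ A → lookup σ x ≡ x
    col-onA      : let ((A , σ , col) , λs) = r in
                   ∀ x → x ∈ A → ∃ λ (i : Fin c) → lookup col x ≡ just i
    col-offA     : let ((A , σ , col) , λs) = r in
                   ∀ x → x ∉ A → lookup col x ≡ nothing
    col-cycle    : let ((A , σ , col) , λs) = r in
                   ∀ x → lookup col (lookup σ x) ≡ lookup col x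
    λ-count      : let ((A , σ , col) , λs) = r in
                   length λs ≡ k
    λ-nonempty   : let ((A , σ , col) , λs) = r in
                   All (λ w → w ≢ []) λs
    λ-strict-disjoint : let ((A , σ , col) , λs) = r in
                   Unique (concat λs)
    λ-covers-B   : let ((A , σ , col) , λs) = r in
                   ∀ x → (x ∈ₗ concat λs) ⇔ (x ∉ A)

-- Two elements are equal iff they have the same A, σ, colouring, and the same
-- *set* of lists (i.e. the lists agree up to reordering).
LCRawSetoid : ℕ → ℕ → Setoid Level.zero Level.zero
LCRawSetoid n c = ×-setoid (≡.setoid (Subset n × Vec (Fin n) n × Vec (Maybe (Fin c)) n)) (↭-setoid {A = List (Fin n)})

LCSetoid : (n k : ℕ) → ℤ → Setoid Level.zero Level.zero
LCSetoid n k α =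
  On.setoid {B = Σ (LCRaw n (numColours α)) (IsLC n k (numColours α))}
            (LCRawSetoid n (numColours α)) proj₁

-- Matchings of K_{n,m} (left vertices Fin n, right vertices Fin m) with
-- exactly e edges; a matching is a set of edges, stored as a list considered
-- up to reordering, no two edges sharing a vertex.

Edge : ℕ → ℕ → Set
Edge n m = Fin n × Fin m

VertexDisjoint : ∀ {n m} → Edge n m → Edge n m → Set
VertexDisjoint (i , j) (i′ , j′) = (i ≢ i′) × (j ≢ j′)

record IsMatching (n m e : ℕ) (es : List (Edge n m)) : Set where
  constructor isMatching
  field
    disjoint : AllPairs VertexDisjoint es
    size     : length es ≡ e

-- M^{n-k}_{n,n+α}: matchings of K_{n,n+α} with exactly n − k edges
-- (the edge count e satisfies e + k = n, so the set is empty when k > n).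
MatchSetoid : (n k : ℕ) → ℤ → Setoid Level.zero Level.zero
MatchSetoid n k α =
  On.setoid {B = Σ (List (Edge n (rightSize n α)))
                   (λ es → Σ ℕ λ e → (e + k ≡ n) × IsMatching n (rightSize n α) e es)}
            (↭-setoid {A = Edge n (rightSize n α)}) proj₁

-- Write c = α + 1.  Both families satisfy the recurrence
--     F (n+1) k  ≅  F n (k-1)  ⊎  F n k × Fin (c + n + k),
-- with one object for n = k = 0 and none for n = 0 < k:
--   * matchings are partial injections with k unmatched left vertices;
--     deleting left vertex 0 and right vertex 0 (splicing the two edges at
--     them) leaves 1 + (n + α) + k = c + n + k choices (PartialInjections);
--   * in LC, deleting the point 0 leaves c choices (0 a coloured fixed point),
--     n choices (the image of 0 in its cycle, or its predecessor in its list) and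
--     k choices (0 sitting at the front of one of the k lists), or the
--     singleton list [0] disappears and k drops by one (LCStepMaps).
module Submission where

open import Defs
open import Level using (0ℓ)
open import Data.Empty using (⊥; ⊥-elim)
open import Data.Unit using (⊤; tt)
open import Data.Bool using (Bool; true; false; if_then_else_)
open import Data.Nat using (ℕ; zero; suc; _+_; _≤_)
open import Data.Nat.Properties using (+-suc; +-cancelˡ-≡; +-comm; +-assoc)
open import Data.Integer as ℤ using (ℤ; -1ℤ) renaming (_≤_ to _≤ℤ_)
open import Data.Fin using (Fin; zero; suc; cast)
open import Data.Fin.Properties using (suc-injective; 0≢1+n; 1↔⊤; +↔⊎; cast-is-id; cast-trans) renaming (_≟_ to _≟F_)
open import Data.Fin.Subset using (Subset; _∈_; _∉_)
open import Data.Vec using (Vec; []; _∷_; lookup; tabulate; here; there; _[_]≔_) renaming (map to vmap)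
open import Data.Vec.Properties using
    (lookup∘tabulate; lookup-map; []=⇒lookup; lookup⇒[]=; lookup∘update; lookup∘update′)
open import Data.Maybe as Maybe using (Maybe; just; nothing)
open import Data.Maybe.Properties using (just-injective)
open import Data.List using (List; []; _∷_; _++_; [_]; map; length; concat; initLast; _∷ʳ′_)
open import Data.List.Properties using (++-assoc; map-++; concat-++; length-map; length-++; map-∘) renaming
    (≡-dec to ≡-decL)
open import Data.List.Membership.Propositional using (lose; find) renaming (_∈_ to _∈ₗ_; _∉_ to _∉ₗ_)
open import Data.List.Membership.Propositional.Properties using
    (∈-map⁺; ∈-map⁻; ∈-++⁻; ∈-++⁺ˡ; ∈-++⁺ʳ; ∈-∃++; ∈-concat⁻′; ∈-concat⁺′)
open import Data.List.Relation.Unary.Any using (Any; here; there; any?)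
import Data.List.Relation.Unary.Any.Properties as Any
open import Data.List.Relation.Unary.All using (All; []; _∷_)
open import Data.List.Relation.Unary.All.Properties using (All¬⇒¬Any; ¬Any⇒All¬)
import Data.List.Relation.Unary.All as All
open import Data.List.Relation.Unary.AllPairs using (AllPairs; []; _∷_)
open import Data.List.Relation.Unary.Unique.Propositional using (Unique)
import Data.List.Relation.Unary.Unique.Propositional.Properties as UP
open import Data.List.Relation.Binary.Permutation.Propositional using
    (_↭_; ↭-refl; ↭-sym; ↭-trans; ↭-prep; ↭-swap; ↭-reflexive; ↭-setoid)
import Data.List.Relation.Binary.Permutation.Propositional as Perm
open import Data.List.Membership.Propositional.Properties.WithK using (unique∧set⇒bag)
open import Data.List.Relation.Binary.BagAndSetEquality using (∼bag⇒↭)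
open import Data.List.Relation.Binary.Permutation.Propositional.Properties using
    (shift; map⁺; Any-resp-↭; ∈-resp-↭; ↭-length)
open import Data.Sum using (_⊎_; inj₁; inj₂)
open import Data.Sum.Relation.Binary.Pointwise using (_⊎ₛ_; inj₁; inj₂)
open import Data.Product using (Σ; _,_; proj₁; proj₂; _×_; ∃; ∃₂)
open import Data.Product.Relation.Binary.Pointwise.NonDependent using (_×ₛ_)
open import Relation.Nullary using (¬_; yes; no; does; Dec)
open import Relation.Nullary.Decidable using (dec-true; dec-false)
open import Relation.Binary.PropositionalEquality as ≡ using (_≡_; _≢_; refl; sym; trans; cong; cong₂; subst)
open import Relation.Binary.Bundles using (Setoid)
open Setoid using (Carrier)
import Relation.Binary.Construct.On as On
open import Function.Bundles using (Inverse; Bijection; _⇔_; mk⇔; Equivalence)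
open import Function.Properties.Inverse using (Inverse⇒Bijection)
import Function.Construct.Composition as Comp
import Function.Construct.Symmetry as Sym
import Function.Construct.Identity as Id
open import Data.Sum.Function.Setoid using (_⊎-inverse_)
open import Data.Sum.Function.Propositional using (_⊎-↔_)
open import Data.Product.Function.NonDependent.Setoid using (_×-inverse_)

false≢true : false ≢ true
false≢true ()

dEq : ∀ {n} (i : Fin n) → does (i ≟F i) ≡ true
dEq i = dec-true (i ≟F i) refl

dNe : ∀ {n} (i j : Fin n) → i ≢ j → does (i ≟F j) ≡ false
dNe i j = dec-false (i ≟F j)

dTrue : ∀ {n} (i j : Fin n) → does (i ≟F j) ≡ true → i ≡ j
dTrue i j e with i ≟F j
... | yes x = x
dTrue i j () | no _

module Recurrence where

  Setoid₀ : Set₁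
  Setoid₀ = Setoid 0ℓ 0ℓ

  _≅_ : Setoid₀ → Setoid₀ → Set
  S ≅ T = Inverse S T

  infixr 4 _⊙_
  _⊙_ : ∀ {R S T} → R ≅ S → S ≅ T → R ≅ T
  f ⊙ g = Comp.inverse f g

  sym-iso : ∀ {S T} → S ≅ T → T ≅ S
  sym-iso = Sym.inverse

  id-iso : ∀ {S} → S ≅ S
  id-iso {S} = Id.inverse S

  mk-iso : ∀ {S T : Setoid₀} (f : Carrier S → Carrier T) (g : Carrier T → Carrier S) →
           (∀ {x y} → Setoid._≈_ S x y → Setoid._≈_ T (f x) (f y)) →
           (∀ {x y} → Setoid._≈_ T x y → Setoid._≈_ S (g x) (g y)) →
           (∀ y → Setoid._≈_ T (f (g y)) y) →
           (∀ x → Setoid._≈_ S (g (f x)) x) → S ≅ T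
  mk-iso {S} {T} f g fc gc l r = record
    { to = f ; from = g ; to-cong = fc ; from-cong = gc
    ; inverse = (λ {x} e → Setoid.trans T (fc e) (l x)) , (λ {x} e → Setoid.trans S (gc e) (r x)) }

  EmptyS : Setoid₀
  EmptyS = ≡.setoid ⊥

  FinS : ℕ → Setoid₀
  FinS n = ≡.setoid (Fin n)

  Prev : (ℕ → Setoid₀) → ℕ → Setoid₀
  Prev F zero = EmptyS
  Prev F (suc k) = F k

  Step : (ℕ → ℕ → ℕ) → (ℕ → ℕ → Setoid₀) → ℕ → ℕ → Setoid₀
  Step w F n k = Prev (F n) k ⊎ₛ (F n k ×ₛ FinS (w n k))

  prev-iso : ∀ {F G : ℕ → Setoid₀} → (∀ k → F k ≅ G k) → ∀ k → Prev F k ≅ Prev G k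
  prev-iso h zero = id-iso
  prev-iso h (suc k) = h k

  recurrence-iso : (w : ℕ → ℕ → ℕ) (F G : ℕ → ℕ → Setoid₀) →
                   (∀ n k → F (suc n) k ≅ Step w F n k) →
                   (∀ n k → G (suc n) k ≅ Step w G n k) →
                   (∀ k → F 0 k ≅ G 0 k) →
                   ∀ n k → F n k ≅ G n k
  recurrence-iso w F G sF sG b zero k = b k
  recurrence-iso w F G sF sG b (suc n) k =
    sF n k ⊙ (prev-iso (rec n) k ⊎-inverse (rec n k ×-inverse id-iso)) ⊙ sym-iso (sG n k)
    where rec = recurrence-iso w F G sF sG b

  -- The canonical solution of the recurrence with weight c + n + k and initial
  -- row "one object for k = 0, none otherwise"; both sides of the theorem are
  -- shown isomorphic to it.
  Canon : ℕ → ℕ → ℕ → Setoid₀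
  CanonPrev : ℕ → ℕ → ℕ → Setoid₀
  Canon c zero zero = ≡.setoid ⊤
  Canon c zero (suc k) = EmptyS
  Canon c (suc n) k = CanonPrev c n k ⊎ₛ (Canon c n k ×ₛ FinS (c + n + k))
  CanonPrev c n zero = EmptyS
  CanonPrev c n (suc k) = Canon c n k

  canon-step : ∀ c n k → Canon c (suc n) k ≅ Step (λ n k → c + n + k) (Canon c) n k
  canon-step c n zero = id-iso
  canon-step c n (suc k) = id-iso

  fin-cast-iso : ∀ {a b} → a ≡ b → FinS a ≅ FinS b
  fin-cast-iso refl = id-iso

  match-choices-iso : ∀ m k → ≡.setoid (⊤ ⊎ (Fin m ⊎ Fin k)) ≅ FinS (suc (m + k))
  match-choices-iso m k = (sym-iso 1↔⊤ ⊎-↔ sym-iso +↔⊎) ⊙ sym-iso +↔⊎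

  LC-choices-iso : ∀ c n k → ≡.setoid (Fin c ⊎ (Fin n ⊎ Fin k)) ≅ FinS (c + n + k)
  LC-choices-iso c n k =
    (Id.↔-id (Fin c) ⊎-↔ sym-iso +↔⊎) ⊙ sym-iso +↔⊎ ⊙ fin-cast-iso (sym (+-assoc c n k))

  empty-iso : ∀ {S T : Setoid₀} → (Carrier S → ⊥) → (Carrier T → ⊥) → S ≅ T
  empty-iso {S} {T} f g = mk-iso {S = S} {T = T} (λ x → ⊥-elim (f x)) (λ y → ⊥-elim (g y))
    (λ {x} _ → ⊥-elim (f x)) (λ {y} _ → ⊥-elim (g y)) (λ y → ⊥-elim (g y)) (λ x → ⊥-elim (f x))

module Search where

  vec-ext : ∀ {A : Set} {n} {xs ys : Vec A n} → (∀ i → lookup xs i ≡ lookup ys i) → xs ≡ ys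
  vec-ext {xs = []} {[]} h = refl
  vec-ext {xs = x ∷ xs} {y ∷ ys} h = cong₂ _∷_ (h zero) (vec-ext (λ i → h (suc i)))

  count : ∀ {n} → Vec Bool n → ℕ
  count [] = 0
  count (true ∷ S) = suc (count S)
  count (false ∷ S) = count S

  rank : ∀ {n} (S : Vec Bool n) (i : Fin n) → lookup S i ≡ true → Fin (count S)
  rank (true ∷ S) zero p = zero
  rank (false ∷ S) zero ()
  rank (true ∷ S) (suc i) p = suc (rank S i p)
  rank (false ∷ S) (suc i) p = rank S i p

  unrank : ∀ {n} (S : Vec Bool n) → Fin (count S) → Fin n
  unrank (true ∷ S) zero = zero
  unrank (true ∷ S) (suc j) = suc (unrank S j)
  unrank (false ∷ S) j = suc (unrank S j)

  unrank∈ : ∀ {n} (S : Vec Bool n) j → lookup S (unrank S j) ≡ true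
  unrank∈ (true ∷ S) zero = refl
  unrank∈ (true ∷ S) (suc j) = unrank∈ S j
  unrank∈ (false ∷ S) j = unrank∈ S j

  rank-unrank : ∀ {n} (S : Vec Bool n) j p → rank S (unrank S j) p ≡ j
  rank-unrank (true ∷ S) zero p = refl
  rank-unrank (true ∷ S) (suc j) p = cong suc (rank-unrank S j p)
  rank-unrank (false ∷ S) j p = rank-unrank S j p

  unrank-rank : ∀ {n} (S : Vec Bool n) i p → unrank S (rank S i p) ≡ i
  unrank-rank (true ∷ S) zero p = refl
  unrank-rank (false ∷ S) zero ()
  unrank-rank (true ∷ S) (suc i) p = cong suc (unrank-rank S i p)
  unrank-rank (false ∷ S) (suc i) p = cong suc (unrank-rank S i p)

  rank-irr : ∀ {n} (S : Vec Bool n) i p q → rank S i p ≡ rank S i q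
  rank-irr (true ∷ S) zero p q = refl
  rank-irr (false ∷ S) zero () q
  rank-irr (true ∷ S) (suc i) p q = cong suc (rank-irr S i p q)
  rank-irr (false ∷ S) (suc i) p q = rank-irr S i p q

  count-remove : ∀ {n} (S T : Vec Bool n) l → lookup S l ≡ true → lookup T l ≡ false →
            (∀ i → i ≢ l → lookup S i ≡ lookup T i) → count S ≡ suc (count T)
  count-remove (true ∷ S) (false ∷ T) zero p q h =
      cong suc (cong count (vec-ext {xs = S} {ys = T} (λ i → h (suc i) (λ ()))))
  count-remove (false ∷ S) T zero () q h
  count-remove (true ∷ S) (true ∷ T) zero p () h
  count-remove (b ∷ S) (b' ∷ T) (suc l) p q h with h zero (λ ())
  ... | e = go b b' e (count-remove S T l p q (λ i i≢l → h (suc i) (λ e → i≢l (suc-injective e))))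
    where
    go : ∀ b b' → b ≡ b' → count S ≡ suc (count T) → count (b ∷ S) ≡ suc (count (b' ∷ T))
    go true .true refl e = cong suc e
    go false .false refl e = e

  first : ∀ {n} → (Fin n → Bool) → Maybe (Fin n)
  first {zero} f = nothing
  first {suc n} f = if f zero then just zero else Maybe.map suc (first (λ i → f (suc i)))

  first-just : ∀ {n} (f : Fin n → Bool) {i} → first f ≡ just i → f i ≡ true
  first-just {suc n} f {i} e with f zero in eq
  first-just {suc n} f {.zero} refl | true = eq
  ... | false with first (λ i → f (suc i)) in eq2
  first-just {suc n} f {.(suc _)} refl | false | just j = first-just (λ i → f (suc i)) eq2

  first-nothing : ∀ {n} (f : Fin n → Bool) → first f ≡ nothing → ∀ i → f i ≡ false
  first-nothing {suc n} f e i with f zero in eq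
  first-nothing {suc n} f () i | true
  ... | false with first (λ i → f (suc i)) in eq2
  first-nothing {suc n} f e zero | false | nothing = eq
  first-nothing {suc n} f e (suc i) | false | nothing = first-nothing (λ i → f (suc i)) eq2 i

  first-uniq : ∀ {n} (f : Fin n → Bool) i → f i ≡ true → (∀ j → f j ≡ true → j ≡ i) → first f ≡ just i
  first-uniq {suc n} f i fi u with f zero in eq
  ... | true = cong just (u zero eq)
  first-uniq {suc n} f zero fi u | false = ⊥-elim (false≢true (trans (sym eq) fi))
  first-uniq {suc n} f (suc i) fi u | false
    rewrite first-uniq (λ i → f (suc i)) i fi (λ j fj → suc-injective (u (suc j) fj)) = refl

  first-cong : ∀ {n} (f g : Fin n → Bool) → (∀ i → f i ≡ g i) → first f ≡ first g
  first-cong {zero} f g h = refl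
  first-cong {suc n} f g h rewrite h zero | first-cong (λ i → f (suc i)) (λ i → g (suc i)) (λ i → h (suc i)) = refl

  count-ext : ∀ {n} (S T : Vec Bool n) → (∀ i → lookup S i ≡ lookup T i) → count S ≡ count T
  count-ext S T h = cong count (vec-ext {xs = S} {ys = T} h)

  first-none : ∀ {n} (f : Fin n → Bool) → (∀ i → f i ≡ false) → first f ≡ nothing
  first-none {zero} f h = refl
  first-none {suc n} f h rewrite h zero | first-none (λ i → f (suc i)) (λ i → h (suc i)) = refl

  cast-rank : ∀ {n k} (S S' : Vec Bool n) → S ≡ S' → ∀ i p p' → .(e : count S ≡ k) → .(e' : count S' ≡ k) →
             cast e (rank S i p) ≡ cast e' (rank S' i p')
  cast-rank S .S refl i p p' e e' = cong (cast e) (rank-irr S i p p')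

  cast-inv : ∀ {a b} .(e : a ≡ b) .(e' : b ≡ a) (x : Fin a) → cast e' (cast e x) ≡ x
  cast-inv e e' x = trans (cast-trans e e' x) (cast-is-id _ x)

module UniqueLists where

  same-elements⇒↭ : ∀ {A : Set} {xs ys : List A} → Unique xs → Unique ys →
                    (∀ {z} → z ∈ₗ xs → z ∈ₗ ys) → (∀ {z} → z ∈ₗ ys → z ∈ₗ xs) → xs ↭ ys
  same-elements⇒↭ ux uy f g = ∼bag⇒↭ (unique∧set⇒bag ux uy (mk⇔ f g))

-- Partial injections Fin n ⇀ Fin m with exactly k undefined points, and the
-- recurrence obtained by deleting left vertex 0 and right vertex 0.
module PartialInjections where

  open Recurrence
  open Search

  -- p i = just j means that left vertex i is matched to right vertex j.
  PInjRaw : ℕ → ℕ → Set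
  PInjRaw n m = Vec (Maybe (Fin m)) n

  isNothing : ∀ {A : Set} → Maybe A → Bool
  isNothing nothing = true
  isNothing (just _) = false

  InjectiveTable : ∀ {n m} → PInjRaw n m → Set
  InjectiveTable p = ∀ i j r → lookup p i ≡ just r → lookup p j ≡ just r → i ≡ j

  unmatched : ∀ {A : Set} {n} → Vec (Maybe A) n → Vec Bool n
  unmatched = vmap isNothing

  record IsPInj (n m k : ℕ) (p : PInjRaw n m) : Set where
    constructor mkPInj
    field
      injective : InjectiveTable p
      unmatched-count : count (unmatched p) ≡ k
  open IsPInj

  PInjC : ℕ → ℕ → ℕ → Set
  PInjC n m k = Σ (PInjRaw n m) (IsPInj n m k)

  PInj : ℕ → ℕ → ℕ → Setoid₀
  PInj n m k = On.setoid {B = PInjC n m k} (≡.setoid (PInjRaw n m)) proj₁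

  isJustZero : ∀ {m} → Maybe (Fin (suc m)) → Bool
  isJustZero (just zero) = true
  isJustZero _ = false

  lowerTarget : ∀ {m} → Maybe (Fin (suc m)) → Maybe (Fin m)
  lowerTarget nothing = nothing
  lowerTarget (just zero) = nothing
  lowerTarget (just (suc r)) = just r

  liftTarget : ∀ {m} → Maybe (Fin m) → Maybe (Fin (suc m))
  liftTarget = Maybe.map suc

  redirect : ∀ {m} → Maybe (Fin (suc m)) → Maybe (Fin (suc m)) → Maybe (Fin (suc m))
  redirect p0 v = if isJustZero v then p0 else v

  -- Delete left vertex 0 (image p0) and right vertex 0: the left vertex
  -- matched to right 0 takes over p0 (or becomes unmatched if p0 = nothing).
  removeVertex : ∀ {n m} → Maybe (Fin (suc m)) → Vec (Maybe (Fin (suc m))) n → PInjRaw n m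
  removeVertex p0 pt = tabulate (λ y → lowerTarget (redirect p0 (lookup pt y)))

  insertBody : ∀ {n m} → (Fin n → Bool) → PInjRaw n m → Fin n → Maybe (Fin (suc m))
  insertBody t p' i = if t i then just zero else liftTarget (lookup p' i)

  insertVertex : ∀ {n m} → Maybe (Fin (suc m)) → (Fin n → Bool) → PInjRaw n m → PInjRaw (suc n) (suc m)
  insertVertex p0 t p' = p0 ∷ tabulate (insertBody t p')

  pointsTo : ∀ {m} → Maybe (Fin m) → Fin m → Bool
  pointsTo nothing r = false
  pointsTo (just x) r = does (x ≟F r)

  hitsZero : ∀ {n m} → Vec (Maybe (Fin (suc m))) n → Fin n → Bool
  hitsZero pt y = isJustZero (lookup pt y)

  isJustZero-true : ∀ {m} (v : Maybe (Fin (suc m))) → isJustZero v ≡ true → v ≡ just zero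
  isJustZero-true (just zero) e = refl
  isJustZero-true nothing ()
  isJustZero-true (just (suc x)) ()

  lower-redirect-just : ∀ {m} (p0 v : Maybe (Fin (suc m))) r → lowerTarget (redirect p0 v) ≡ just r →
        (v ≡ just zero × p0 ≡ just (suc r)) ⊎ (v ≡ just (suc r))
  lower-redirect-just p0 nothing r ()
  lower-redirect-just (just (suc x)) (just zero) r refl = inj₁ (refl , refl)
  lower-redirect-just (just zero) (just zero) r ()
  lower-redirect-just nothing (just zero) r ()
  lower-redirect-just p0 (just (suc x)) r refl = inj₂ refl

  removeVertex-injective : ∀ {n m} (p0 : Maybe (Fin (suc m))) (pt : Vec _ n) →
    InjectiveTable (p0 ∷ pt) →
    InjectiveTable (removeVertex p0 pt)
  removeVertex-injective p0 pt inj i j r ei ej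
    with lower-redirect-just p0 (lookup pt i) r (trans (sym (lookup∘tabulate _ i)) ei) | lower-redirect-just p0
        (lookup pt j) r (trans (sym (lookup∘tabulate _ j)) ej)
  ... | inj₁ (a , b) | inj₁ (a' , b') = suc-injective (inj (suc i) (suc j) zero a a')
  ... | inj₁ (a , b) | inj₂ c = ⊥-elim (0≢1+n (inj zero (suc j) (suc r) b c))
  ... | inj₂ c | inj₁ (a , b) = ⊥-elim (0≢1+n (inj zero (suc i) (suc r) b c))
  ... | inj₂ c | inj₂ c' = suc-injective (inj (suc i) (suc j) (suc r) c c')

  isNothing-lower : ∀ {m} (p0 v : Maybe (Fin (suc m))) → isJustZero v ≡ false →
      isNothing (lowerTarget (redirect p0 v)) ≡ isNothing v
  isNothing-lower p0 nothing e = refl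
  isNothing-lower p0 (just (suc x)) e = refl
  isNothing-lower p0 (just zero) ()

  not-isJustZero : ∀ {m} (v : Maybe (Fin (suc m))) → v ≢ just zero → isJustZero v ≡ false
  not-isJustZero nothing h = refl
  not-isJustZero (just zero) h = ⊥-elim (h refl)
  not-isJustZero (just (suc x)) h = refl

  unmatched-lookup : ∀ {A : Set} {n} (p : Vec (Maybe A) n) i → lookup (unmatched p) i ≡ isNothing (lookup p i)
  unmatched-lookup p i = lookup-map i isNothing p

  others-miss-zero : ∀ {n m} (p0 : Maybe (Fin (suc m))) (pt : Vec _ n) →
    InjectiveTable (p0 ∷ pt) →
    p0 ≡ just zero → ∀ i → isJustZero (lookup pt i) ≡ false
  others-miss-zero p0 pt inj e i = not-isJustZero _ (λ h → 0≢1+n (inj zero (suc i) zero e h))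

  unique-hits-zero : ∀ {n m} (p0 : Maybe (Fin (suc m))) (pt : Vec _ n) →
    InjectiveTable (p0 ∷ pt) →
    ∀ l → lookup pt l ≡ just zero → ∀ i → i ≢ l → isJustZero (lookup pt i) ≡ false
  unique-hits-zero p0 pt inj l e i i≢l = not-isJustZero _ (λ h → i≢l (suc-injective (inj (suc i) (suc l) zero h e)))

  count-remove-same : ∀ {n m} (p0 : Maybe (Fin (suc m))) (pt : Vec _ n) → (∀ i → isJustZero (lookup pt i) ≡ false) →
    count (unmatched (removeVertex p0 pt)) ≡ count (unmatched pt)
  count-remove-same p0 pt h =
      count-ext (unmatched (removeVertex p0 pt)) (unmatched pt) ((λ i → trans (unmatched-lookup (removeVertex p0 pt) i)
     (trans (cong isNothing (lookup∘tabulate _ i))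
         (trans (isNothing-lower p0 (lookup pt i) (h i)) (sym (unmatched-lookup pt i))))))

  isNothing-lower-redirect : ∀ {m} (r : Fin m) v → isNothing (lowerTarget (redirect (just (suc r)) v)) ≡ isNothing v
  isNothing-lower-redirect r nothing = refl
  isNothing-lower-redirect r (just zero) = refl
  isNothing-lower-redirect r (just (suc x)) = refl

  count-remove-redirect : ∀ {n m} (r : Fin m) (pt : Vec _ n) →
      count (unmatched (removeVertex (just (suc r)) pt)) ≡ count (unmatched pt)
  count-remove-redirect r pt =
      count-ext (unmatched (removeVertex (just (suc r)) pt)) (unmatched pt)
      ((λ i → trans (unmatched-lookup (removeVertex _ pt) i)
     (trans (cong isNothing (lookup∘tabulate _ i))
         (trans (isNothing-lower-redirect r (lookup pt i)) (sym (unmatched-lookup pt i))))))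

  remove-makes-unmatched : ∀ {n m} (pt : Vec (Maybe (Fin (suc m))) n) l → lookup pt l ≡ just zero →
      lookup (unmatched (removeVertex nothing pt)) l ≡ true
  remove-makes-unmatched pt l e =
      trans (unmatched-lookup (removeVertex nothing pt) l)
      (trans (cong isNothing (lookup∘tabulate _ l)) (cong (λ v → isNothing (lowerTarget (redirect nothing v))) e))

  count-remove-one : ∀ {n m} (pt : Vec (Maybe (Fin (suc m))) n) →
    InjectiveTable (nothing ∷ pt) →
    ∀ l → lookup pt l ≡ just zero → count (unmatched (removeVertex nothing pt)) ≡ suc (count (unmatched pt))
  count-remove-one pt inj l e =
      count-remove (unmatched (removeVertex nothing pt)) (unmatched pt) l (remove-makes-unmatched pt l e)
    (trans (unmatched-lookup pt l) (cong isNothing e))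
    (λ i i≢l → trans (unmatched-lookup (removeVertex nothing pt) i) (trans (cong isNothing (lookup∘tabulate _ i))
       (trans (isNothing-lower nothing (lookup pt i) (unique-hits-zero nothing pt inj l e i i≢l))
           (sym (unmatched-lookup pt i)))))

  liftTarget-just : ∀ {m} (u : Maybe (Fin m)) {r} → liftTarget u ≡ just r → Σ (Fin m) (λ r' → u ≡ just r' × r ≡ suc r')
  liftTarget-just (just x) refl = x , refl , refl
  liftTarget-just nothing ()

  liftTarget≢zero : ∀ {m} (u : Maybe (Fin m)) → just zero ≡ liftTarget u → ⊥
  liftTarget≢zero nothing ()
  liftTarget≢zero (just x) ()

  insert-entry : ∀ {n m} p0 (t : Fin n → Bool) (p' : PInjRaw n m) i →
        lookup (insertVertex p0 t p') (suc i) ≡ (if t i then just zero else liftTarget (lookup p' i))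
  insert-entry p0 t p' i = lookup∘tabulate _ i

  insert-entry-selected : ∀ {n m} p0 (t : Fin n → Bool) (p' : PInjRaw n m) i → t i ≡ true →
      lookup (insertVertex p0 t p') (suc i) ≡ just zero
  insert-entry-selected p0 t p' i e =
      trans (insert-entry p0 t p' i) (cong (λ b → if b then just zero else liftTarget (lookup p' i)) e)

  insert-entry-unselected : ∀ {n m} p0 (t : Fin n → Bool) (p' : PInjRaw n m) i → t i ≡ false →
      lookup (insertVertex p0 t p') (suc i) ≡ liftTarget (lookup p' i)
  insert-entry-unselected p0 t p' i e =
      trans (insert-entry p0 t p' i) (cong (λ b → if b then just zero else liftTarget (lookup p' i)) e)

  insertVertex-injective : ∀ {n m} p0 (t : Fin n → Bool) (p' : PInjRaw n m) →
    InjectiveTable p' →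
    (∀ i j → t i ≡ true → t j ≡ true → i ≡ j) →
    (∀ i → t i ≡ true → p0 ≢ just zero) →
    (∀ i r → p0 ≡ just (suc r) → t i ≡ false → lookup p' i ≢ just r) →
    InjectiveTable (insertVertex p0 t p')
  insertVertex-injective p0 t p' h1 h2 h3 h4 = go
    where
    side : ∀ j r → p0 ≡ just r → lookup (insertVertex p0 t p') (suc j) ≡ just r → ⊥
    side j r e1 e2 with t j in tj
    ... | true = h3 j tj (trans e1 (trans (sym e2) (insert-entry-selected p0 t p' j tj)))
    ... | false with liftTarget-just (lookup p' j) (trans (sym (insert-entry-unselected p0 t p' j tj)) e2)
    ... | r' , a , b = h4 j r' (trans e1 (cong just b)) tj a
    go : InjectiveTable (insertVertex p0 t p')
    go zero zero r e1 e2 = refl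
    go zero (suc j) r e1 e2 = ⊥-elim (side j r e1 e2)
    go (suc i) zero r e1 e2 = ⊥-elim (side i r e2 e1)
    go (suc i) (suc j) r e1 e2 with t i in ti | t j in tj
    ... | true | true = cong suc (h2 i j ti tj)
    ... | true | false = ⊥-elim
        (liftTarget≢zero (lookup p' j)
        (trans (trans (sym (insert-entry-selected p0 t p' i ti)) e1)
        (trans (sym e2) (insert-entry-unselected p0 t p' j tj))))
    ... | false | true = ⊥-elim
        (liftTarget≢zero (lookup p' i)
        (trans (trans (sym (insert-entry-selected p0 t p' j tj)) e2)
        (trans (sym e1) (insert-entry-unselected p0 t p' i ti))))
    ... | false | false with liftTarget-just (lookup p' i) (trans (sym (insert-entry-unselected p0 t p' i ti)) e1)
                          | liftTarget-just (lookup p' j) (trans (sym (insert-entry-unselected p0 t p' j tj)) e2)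
    ... | r1 , a1 , b1 | r2 , a2 , b2 =
        cong suc (h1 i j r1 a1 (trans a2 (cong just (suc-injective (trans (sym b2) b1)))))

  isNothing-lift : ∀ {m} (u : Maybe (Fin m)) → isNothing (liftTarget u) ≡ isNothing u
  isNothing-lift nothing = refl
  isNothing-lift (just x) = refl

  count-insert-none : ∀ {n m} (p' : PInjRaw n m) →
      count (unmatched (tabulate (insertBody (λ _ → false) p'))) ≡ count (unmatched p')
  count-insert-none p' = count-ext (unmatched (tabulate (insertBody (λ _ → false) p'))) (unmatched p')
      (λ i → trans (unmatched-lookup (tabulate (insertBody (λ _ → false) p')) i)
      (trans (cong isNothing (lookup∘tabulate (insertBody (λ _ → false) p') i))
      (trans (isNothing-lift (lookup p' i)) (sym (unmatched-lookup p' i)))))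

  isNothing-raise : ∀ {m} (u : Maybe (Fin m)) r →
      isNothing (if pointsTo u r then just zero else liftTarget u) ≡ isNothing u
  isNothing-raise nothing r = refl
  isNothing-raise (just x) r with does (x ≟F r)
  ... | true = refl
  ... | false = refl

  count-insert-redirect : ∀ {n m} r (p' : PInjRaw n m) →
      count (unmatched (tabulate (insertBody (λ i → pointsTo (lookup p' i) r) p'))) ≡ count (unmatched p')
  count-insert-redirect r p' =
      count-ext (unmatched (tabulate (insertBody (λ i → pointsTo (lookup p' i) r) p'))) (unmatched p')
      (λ i → trans (unmatched-lookup (tabulate (insertBody (λ i → pointsTo (lookup p' i) r) p')) i)
      (trans (cong isNothing (lookup∘tabulate (insertBody (λ i → pointsTo (lookup p' i) r) p') i))
      (trans (isNothing-raise (lookup p' i) r) (sym (unmatched-lookup p' i)))))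

  count-insert-one : ∀ {n m} (p' : PInjRaw n m) l → lookup (unmatched p') l ≡ true →
    count (unmatched p') ≡ suc (count (unmatched (tabulate (insertBody (λ i → does (i ≟F l)) p'))))
  count-insert-one p' l e = count-remove (unmatched p') (unmatched (tabulate (insertBody (λ i → does (i ≟F l)) p'))) l e
    (trans (unmatched-lookup (tabulate (insertBody (λ i → does (i ≟F l)) p')) l)
        (trans (cong isNothing (lookup∘tabulate (insertBody (λ i → does (i ≟F l)) p') l))
        (cong (λ b → isNothing (if b then just zero else liftTarget (lookup p' l))) (dEq l))))
    (λ i i≢l → sym (trans (unmatched-lookup (tabulate (insertBody (λ i → does (i ≟F l)) p')) i)
        (trans (cong isNothing (lookup∘tabulate (insertBody (λ i → does (i ≟F l)) p') i))
       (trans (cong (λ b → isNothing (if b then just zero else liftTarget (lookup p' i))) (dNe i l i≢l))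
           (trans (isNothing-lift (lookup p' i)) (sym (unmatched-lookup p' i)))))))

  lower-lift : ∀ {m} p0 (u : Maybe (Fin m)) → lowerTarget (redirect p0 (liftTarget u)) ≡ u
  lower-lift p0 nothing = refl
  lower-lift p0 (just x) = refl

  remove-insert : ∀ {n m} p0 (t : Fin n → Bool) (p' : PInjRaw n m) → (∀ i → t i ≡ true → lowerTarget p0 ≡ lookup p' i) →
            removeVertex p0 (tabulate (insertBody t p')) ≡ p'
  remove-insert p0 t p' h = vec-ext
      (λ i → trans (lookup∘tabulate (λ y → lowerTarget (redirect p0 (lookup (tabulate (insertBody t p')) y))) i)
      (trans (cong (λ v → lowerTarget (redirect p0 v)) (lookup∘tabulate (insertBody t p') i)) (go i)))
    where
    go : ∀ i → lowerTarget (redirect p0 (if t i then just zero else liftTarget (lookup p' i))) ≡ lookup p' i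
    go i with t i in ti
    ... | true = h i ti
    ... | false = lower-lift p0 (lookup p' i)

  lift-lower : ∀ {m} p0 (v : Maybe (Fin (suc m))) → isJustZero v ≡ false → liftTarget (lowerTarget (redirect p0 v)) ≡ v
  lift-lower p0 nothing e = refl
  lift-lower p0 (just (suc x)) e = refl
  lift-lower p0 (just zero) ()

  pointsTo-true : ∀ {m} (u : Maybe (Fin m)) r → pointsTo u r ≡ true → u ≡ just r
  pointsTo-true nothing r ()
  pointsTo-true (just x) r e = cong just (dTrue x r e)

  pointsTo-refl : ∀ {m} (r : Fin m) → pointsTo (just r) r ≡ true
  pointsTo-refl r = dEq r

  MatchChoice : ℕ → ℕ → Set
  MatchChoice m k = ⊤ ⊎ (Fin m ⊎ Fin k)

  -- The right-hand side of the recurrence, with the choice set 1 + m + k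
  -- (left 0 matched to right 0 / to right r + 1 / unmatched with a rank in Fin k).
  PInjStep : ℕ → ℕ → ℕ → Setoid₀
  PInjStep n m k = Prev (PInj n m) k ⊎ₛ (PInj n m k ×ₛ ≡.setoid (MatchChoice m k))

  mkPrevPInj : ∀ {n m k'} kk → kk ≡ suc k' → PInjC n m k' → Carrier (Prev (PInj n m) kk)
  mkPrevPInj .(suc _) refl x = x

  mkPrevPInj-raw : ∀ {n m k'} k0 (e : suc k0 ≡ suc k') (x : PInjC n m k') → proj₁ (mkPrevPInj (suc k0) e x) ≡ proj₁ x
  mkPrevPInj-raw k0 refl x = refl

  mkPrevPInj-cong : ∀ {n m k'} kk (e e' : kk ≡ suc k') (x x' : PInjC n m k') → proj₁ x ≡ proj₁ x' →
                Setoid._≈_ (Prev (PInj n m) kk) (mkPrevPInj kk e x) (mkPrevPInj kk e' x')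
  mkPrevPInj-cong .(suc _) refl refl x x' h = h

  prev-valid : ∀ {n m k'} (p' : PInjRaw n m) → IsPInj n m k' p' →
      IsPInj (suc n) (suc m) (suc k') (insertVertex nothing (λ _ → false) p')
  prev-valid p' v' = mkPInj (insertVertex-injective nothing (λ _ → false) p' (injective v') (λ i j ()) (λ i ())
      (λ i r ()))
                  (cong suc (trans (count-insert-none p') (unmatched-count v')))

  pinj-join-prev : ∀ {n m} kk → Carrier (Prev (PInj n m) kk) → PInjC (suc n) (suc m) kk
  pinj-join-prev zero ()
  pinj-join-prev (suc k') (p' , v') = insertVertex nothing (λ _ → false) p' , prev-valid p' v'

  module _ {n m k : ℕ} where

    -- Decomposition when left vertex 0 is unmatched: either right vertex 0
    -- is unmatched too (one fewer unmatched vertex), or it is matched to l,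
    -- which becomes unmatched and is recorded by its rank.
    split-unmatched : (pt : Vec (Maybe (Fin (suc m))) n) → IsPInj (suc n) (suc m) k (nothing ∷ pt) →
          (w : Maybe (Fin n)) → first (hitsZero pt) ≡ w → Carrier (PInjStep n m k)
    split-unmatched pt v (just l) e =
        inj₂ ((removeVertex nothing pt , mkPInj (removeVertex-injective _ pt (injective v)) cL) ,
                         inj₂ (inj₂ (cast cL (rank (unmatched (removeVertex nothing pt)) l
                             (remove-makes-unmatched pt l ej)))))
      where
      ej = isJustZero-true _ (first-just (hitsZero pt) e)
      cL = trans (count-remove-one pt (injective v) l ej) (unmatched-count v)
    split-unmatched pt v nothing e =
        inj₁ (mkPrevPInj k (sym (unmatched-count v))
        (removeVertex nothing pt ,
        mkPInj (removeVertex-injective _ pt (injective v))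
        (count-remove-same nothing pt (first-nothing (hitsZero pt) e))))

    pinj-split : PInjC (suc n) (suc m) k → Carrier (PInjStep n m k)
    pinj-split (just zero ∷ pt , v) =
      inj₂ ((removeVertex (just zero) pt ,
          mkPInj (removeVertex-injective _ pt (injective v))
          (trans (count-remove-same _ pt (others-miss-zero _ pt (injective v) refl)) (unmatched-count v))) , inj₁ tt)
    pinj-split (just (suc r) ∷ pt , v) =
      inj₂ ((removeVertex (just (suc r)) pt ,
          mkPInj (removeVertex-injective _ pt (injective v))
          (trans (count-remove-redirect r pt) (unmatched-count v))) , inj₂ (inj₁ r))
    pinj-split (nothing ∷ pt , v) = split-unmatched pt v (first (hitsZero pt)) refl

    pinj-join : Carrier (PInjStep n m k) → PInjC (suc n) (suc m) k
    pinj-join (inj₁ x) = pinj-join-prev k x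
    pinj-join (inj₂ ((p' , v') , inj₁ tt)) =
      insertVertex (just zero) (λ _ → false) p' ,
      mkPInj (insertVertex-injective (just zero) (λ _ → false) p' (injective v') (λ i j ()) (λ i ()) (λ i r ()))
          (trans (count-insert-none p') (unmatched-count v'))
    pinj-join (inj₂ ((p' , v') , inj₂ (inj₁ r))) =
      insertVertex (just (suc r)) (λ i → pointsTo (lookup p' i) r) p' ,
      mkPInj (insertVertex-injective (just (suc r)) (λ i → pointsTo (lookup p' i) r) p' (injective v')
              (λ i j ti tj → injective v' i j r (pointsTo-true _ r ti) (pointsTo-true _ r tj))
              (λ i _ ())
              (λ { i .r refl ti e → false≢true
                  (trans (sym ti) (trans (cong (λ u → pointsTo u r) e) (pointsTo-refl r))) }))
           (trans (count-insert-redirect r p') (unmatched-count v'))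
    pinj-join (inj₂ ((p' , v') , inj₂ (inj₂ q))) =
      insertVertex nothing (λ i → does (i ≟F unrank (unmatched p') (cast (sym (unmatched-count v')) q))) p' ,
      mkPInj (insertVertex-injective nothing
          (λ i → does (i ≟F unrank (unmatched p') (cast (sym (unmatched-count v')) q))) p' (injective v')
              (λ i j ti tj → trans (dTrue i _ ti) (sym (dTrue j _ tj))) (λ i _ ()) (λ i r ()))
           (trans (sym (count-insert-one p' (unrank (unmatched p') (cast (sym (unmatched-count v')) q))
               (unrank∈ (unmatched p') (cast (sym (unmatched-count v')) q)))) (unmatched-count v'))

    pinj-split-cong : ∀ {x y : PInjC (suc n) (suc m) k} → proj₁ x ≡ proj₁ y →
        Setoid._≈_ (PInjStep n m k) (pinj-split x) (pinj-split y)
    pinj-split-cong {just zero ∷ pt , v} {_ , w} refl = inj₂ (refl , refl)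
    pinj-split-cong {just (suc r) ∷ pt , v} {_ , w} refl = inj₂ (refl , refl)
    pinj-split-cong {nothing ∷ pt , v} {_ , w} refl = toN-cong pt v w (first (hitsZero pt)) refl
      where
      toN-cong : ∀ pt v w (u : Maybe (Fin n)) (e : first (hitsZero pt) ≡ u) →
          Setoid._≈_ (PInjStep n m k) (split-unmatched pt v u e) (split-unmatched pt w u e)
      toN-cong pt v w (just l) e = inj₂ (refl , refl)
      toN-cong pt v w nothing e = inj₁ (mkPrevPInj-cong k _ _ _ _ refl)

    prevCong : ∀ kk (x y : Carrier (Prev (PInj n m) kk)) → Setoid._≈_ (Prev (PInj n m) kk) x y →
               proj₁ (pinj-join-prev kk x) ≡ proj₁ (pinj-join-prev kk y)
    prevCong zero () y r
    prevCong (suc k') x y r = cong (insertVertex nothing (λ _ → false)) r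

    pinj-join-cong : ∀ {x y} → Setoid._≈_ (PInjStep n m k) x y → proj₁ (pinj-join x) ≡ proj₁ (pinj-join y)
    pinj-join-cong {inj₁ x} {inj₁ y} (inj₁ r) = prevCong k x y r
    pinj-join-cong {inj₂ ((p' , v') , inj₁ tt)} {inj₂ ((_ , w') , _)} (inj₂ (refl , refl)) = refl
    pinj-join-cong {inj₂ ((p' , v') , inj₂ (inj₁ r))} {inj₂ ((_ , w') , _)} (inj₂ (refl , refl)) = refl
    pinj-join-cong {inj₂ ((p' , v') , inj₂ (inj₂ q))} {inj₂ ((_ , w') , _)} (inj₂ (refl , refl)) = refl

  isNothing-true : ∀ {A : Set} (u : Maybe A) → isNothing u ≡ true → u ≡ nothing
  isNothing-true nothing e = refl
  isNothing-true (just x) ()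

  hitsZero-selected : ∀ {n m} (t : Fin n → Bool) (p' : PInjRaw n m) i → isJustZero (insertBody t p' i) ≡ true →
      t i ≡ true
  hitsZero-selected t p' i e with t i
  ... | true = refl
  hitsZero-selected t p' i e | false with lookup p' i
  hitsZero-selected t p' i () | false | nothing
  hitsZero-selected t p' i () | false | just x

  hitsZero-insert : ∀ {n m} (t : Fin n → Bool) (p' : PInjRaw n m) i →
      hitsZero (tabulate (insertBody t p')) i ≡ isJustZero (insertBody t p' i)
  hitsZero-insert t p' i = cong isJustZero (lookup∘tabulate (insertBody t p') i)

  pinj-to∘from-prev : ∀ {n m k'} (x : PInjC n m k') →
      Setoid._≈_ (PInjStep n m (suc k')) (pinj-split (pinj-join-prev (suc k') x)) (inj₁ x)
  pinj-to∘from-prev {n} {m} {k'} (p' , v') = go (first (hitsZero tab)) refl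
    where
    tab = tabulate (insertBody (λ _ → false) p')
    go : ∀ u (e : first (hitsZero tab) ≡ u) →
        Setoid._≈_ (PInjStep n m (suc k')) (split-unmatched tab (prev-valid p' v') u e) (inj₁ (p' , v'))
    go (just l) e = ⊥-elim (false≢true
        (hitsZero-selected (λ _ → false) p' l
        (trans (sym (hitsZero-insert (λ _ → false) p' l)) (first-just (hitsZero tab) e))))
    go nothing e = inj₁ (trans (mkPrevPInj-raw k' (sym (unmatched-count (prev-valid p' v'))) _)
        (remove-insert nothing (λ _ → false) p' (λ i ())))

  pinj-to∘from : ∀ {n m k} y → Setoid._≈_ (PInjStep n m k) (pinj-split (pinj-join y)) y
  pinj-to∘from {k = zero} (inj₁ ())
  pinj-to∘from {k = suc k'} (inj₁ x) = pinj-to∘from-prev x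
  pinj-to∘from (inj₂ ((p' , v') , inj₁ tt)) = inj₂ (remove-insert (just zero) (λ _ → false) p' (λ i ()) , refl)
  pinj-to∘from (inj₂ ((p' , v') , inj₂ (inj₁ r))) =
    inj₂ (remove-insert (just (suc r)) (λ i → pointsTo (lookup p' i) r) p' (λ i ti → sym (pointsTo-true _ r ti)) , refl)
  pinj-to∘from {n} {m} {k} (inj₂ ((p' , v') , inj₂ (inj₂ q))) = go (first (hitsZero tab)) refl
    where
    L = unrank (unmatched p') (cast (sym (unmatched-count v')) q)
    t = λ i → does (i ≟F L)
    tab = tabulate (insertBody t p')
    W = proj₂ (pinj-join {n} {m} {k} (inj₂ ((p' , v') , inj₂ (inj₂ q))))
    pL : lookup p' L ≡ nothing
    pL = isNothing-true _ (trans (sym (unmatched-lookup p' L))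
        (unrank∈ (unmatched p') (cast (sym (unmatched-count v')) q)))
    del : removeVertex nothing tab ≡ p'
    del = remove-insert nothing t p' (λ i ti → trans (sym pL) (cong (lookup p') (sym (dTrue i L ti))))
    tL : hitsZero tab L ≡ true
    tL = trans (hitsZero-insert t p' L)
        (cong (λ b → isJustZero (if b then just zero else liftTarget (lookup p' L))) (dEq L))
    go : ∀ u (e : first (hitsZero tab) ≡ u) →
        Setoid._≈_ (PInjStep n m k) (split-unmatched tab W u e) (inj₂ ((p' , v') , inj₂ (inj₂ q)))
    go nothing e = ⊥-elim (false≢true (trans (sym (first-nothing (hitsZero tab) e L)) tL))
    go (just l) e with dTrue l L
        (hitsZero-selected t p' l (trans (sym (hitsZero-insert t p' l)) (first-just (hitsZero tab) e)))
    ... | refl = inj₂ (del , cong (λ z → inj₂ (inj₂ z))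
          (trans (cast-rank (unmatched (removeVertex nothing tab)) (unmatched p') (cong unmatched del) L _
              (unrank∈ (unmatched p') (cast (sym (unmatched-count v')) q)) _ (unmatched-count v'))
          (trans (cong (cast (unmatched-count v'))
              (rank-unrank (unmatched p') (cast (sym (unmatched-count v')) q) _))
              (cast-inv (sym (unmatched-count v')) (unmatched-count v') q))))

  redirect-entry : ∀ {m} (r : Fin m) (v : Maybe (Fin (suc m))) → v ≢ just (suc r) →
    (if pointsTo (lowerTarget (redirect (just (suc r)) v)) r then just zero else liftTarget
        (lowerTarget (redirect (just (suc r)) v))) ≡ v
  redirect-entry r nothing h = refl
  redirect-entry r (just zero) h rewrite dEq r = refl
  redirect-entry r (just (suc x)) h with x ≟F r
  ... | yes e = ⊥-elim (h (cong (λ z → just (suc z)) e))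
  ... | no _ = refl

  pinj-join-prev-mkPrev : ∀ {n m k'} kk (e : kk ≡ suc k') (x : PInjC n m k') →
    proj₁ (pinj-join-prev kk (mkPrevPInj kk e x)) ≡ insertVertex nothing (λ _ → false) (proj₁ x)
  pinj-join-prev-mkPrev .(suc _) refl x = refl

  pinj-from∘to : ∀ {n m k} (x : PInjC (suc n) (suc m) k) → proj₁ (pinj-join (pinj-split x)) ≡ proj₁ x
  pinj-from∘to (just zero ∷ pt , v) = cong (just zero ∷_) (vec-ext (λ i →
    trans (lookup∘tabulate (insertBody (λ _ → false) (removeVertex (just zero) pt)) i)
        (trans (cong liftTarget (lookup∘tabulate _ i))
       (lift-lower (just zero) (lookup pt i) (others-miss-zero _ pt (injective v) refl i)))))
  pinj-from∘to (just (suc r) ∷ pt , v) = cong (just (suc r) ∷_) (vec-ext (λ i →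
    trans (lookup∘tabulate (insertBody (λ i → pointsTo (lookup (removeVertex (just (suc r)) pt) i) r)
        (removeVertex (just (suc r)) pt)) i)
     (trans (cong (λ w → if pointsTo w r then just zero else liftTarget w)
         (lookup∘tabulate (λ y → lowerTarget (redirect (just (suc r)) (lookup pt y))) i))
       (redirect-entry r (lookup pt i) (λ h → 0≢1+n (injective v zero (suc i) (suc r) refl h))))))
  pinj-from∘to {n} {m} {k} (nothing ∷ pt , v) = go (first (hitsZero pt)) refl
    where
    go : ∀ u (e : first (hitsZero pt) ≡ u) → proj₁ (pinj-join (split-unmatched pt v u e)) ≡ nothing ∷ pt
    go nothing e = trans (pinj-join-prev-mkPrev k (sym (unmatched-count v)) _) (cong (nothing ∷_) (vec-ext (λ i →
       trans (lookup∘tabulate (insertBody (λ _ → false) (removeVertex nothing pt)) i)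
           (trans (cong liftTarget (lookup∘tabulate _ i))
         (lift-lower nothing (lookup pt i) (first-nothing (hitsZero pt) e i))))))
    go (just l) e = cong (nothing ∷_) (vec-ext (λ i → trans (lookup∘tabulate (insertBody t p'') i) (ent' i)))
      where
      ej = isJustZero-true _ (first-just (hitsZero pt) e)
      p'' = removeVertex nothing pt
      cL = trans (count-remove-one pt (injective v) l ej) (unmatched-count v)
      L = unrank (unmatched p'') (cast (sym cL) (cast cL (rank (unmatched p'') l (remove-makes-unmatched pt l ej))))
      t = λ i → does (i ≟F L)
      L≡l : L ≡ l
      L≡l = trans (cong (unrank (unmatched p'')) (cast-inv cL (sym cL) _)) (unrank-rank (unmatched p'') l _)
      ent' : ∀ i → insertBody t p'' i ≡ lookup pt i
      ent' i with i ≟F L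
      ... | yes i≡L = trans (sym ej) (cong (lookup pt) (sym (trans i≡L L≡l)))
      ... | no i≢L = trans (cong liftTarget (lookup∘tabulate _ i)) (lift-lower nothing (lookup pt i)
                       (unique-hits-zero nothing pt (injective v) l ej i (λ h → i≢L (trans h (sym L≡l)))))

  pinj-step : ∀ n m k → PInj (suc n) (suc m) k ≅ (Prev (PInj n m) k ⊎ₛ (PInj n m k ×ₛ FinS (suc (m + k))))
  pinj-step n m k = mk-iso {S = PInj (suc n) (suc m) k} {T = PInjStep n m k} pinj-split pinj-join pinj-split-cong
      pinj-join-cong pinj-to∘from pinj-from∘to
                 ⊙ (id-iso ⊎-inverse (id-iso ×-inverse match-choices-iso m k))

-- A matching of K_{n,m} with n − k edges is the same as a partial injection
-- with k unmatched left vertices (read off edge lists up to reordering).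
module Matchings where

  open Recurrence
  open Search
  open PartialInjections
  open UniqueLists

  MatchC : ℕ → ℕ → ℕ → Set
  MatchC n m k = Σ (List (Edge n m)) (λ es → Σ ℕ λ e → (e + k ≡ n) × IsMatching n m e es)

  Match : ℕ → ℕ → ℕ → Setoid₀
  Match n m k = On.setoid {B = MatchC n m k} (↭-setoid {A = Edge n m}) proj₁

  partner : ∀ {n m} → Fin n → List (Edge n m) → Maybe (Fin m)
  partner i [] = nothing
  partner i ((a , b) ∷ es) = if does (a ≟F i) then just b else partner i es

  partner-sound : ∀ {n m} (i : Fin n) (es : List (Edge n m)) {b} → partner i es ≡ just b → (i , b) ∈ₗ es
  partner-sound i [] ()
  partner-sound i ((a , b') ∷ es) e with a ≟F i
  partner-sound i ((.i , b') ∷ es) refl | yes refl = here refl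
  ... | no _ = there (partner-sound i es e)

  partner-complete : ∀ {n m} (i : Fin n) (es : List (Edge n m)) {b} → AllPairs VertexDisjoint es → (i , b) ∈ₗ es →
      partner i es ≡ just b
  partner-complete i ((a , b') ∷ es) (px ∷ ap) (here refl) with a ≟F a
  ... | yes _ = refl
  ... | no ne = ⊥-elim (ne refl)
  partner-complete i ((a , b') ∷ es) (px ∷ ap) (there m) with a ≟F i
  ... | yes refl = ⊥-elim (proj₁ (All.lookup px m) refl)
  ... | no _ = partner-complete i es ap m

  disjoint-same-right : ∀ {n m} {es : List (Edge n m)} {x y} → AllPairs VertexDisjoint es → x ∈ₗ es → y ∈ₗ es →
      proj₂ x ≡ proj₂ y → x ≡ y
  disjoint-same-right (px ∷ ap) (here refl) (here refl) e = refl
  disjoint-same-right (px ∷ ap) (here refl) (there my) e = ⊥-elim (proj₂ (All.lookup px my) e)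
  disjoint-same-right (px ∷ ap) (there mx) (here refl) e = ⊥-elim (proj₂ (All.lookup px mx) (sym e))
  disjoint-same-right (px ∷ ap) (there mx) (there my) e = disjoint-same-right ap mx my e

  disjoint⇒unique : ∀ {n m} {es : List (Edge n m)} → AllPairs VertexDisjoint es → Unique es
  disjoint⇒unique [] = []
  disjoint⇒unique (px ∷ ap) = All.map (λ { (a , b) refl → a refl }) px ∷ disjoint⇒unique ap

  unique⇒AllPairs : ∀ {A : Set} {R : A → A → Set} {l : List A} → Unique l →
      (∀ {x y} → x ∈ₗ l → y ∈ₗ l → x ≢ y → R x y) → AllPairs R l
  unique⇒AllPairs [] h = []
  unique⇒AllPairs (px ∷ u) h =
      All.tabulate (λ m → h (here refl) (there m) (All.lookup px m)) ∷ unique⇒AllPairs u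
      (λ mx my → h (there mx) (there my))

  shiftEdge : ∀ {n m} → Edge n m → Edge (suc n) m
  shiftEdge (a , b) = suc a , b

  headEdges : ∀ {n m} → Maybe (Fin m) → List (Edge (suc n) m)
  headEdges nothing = []
  headEdges (just b) = [ (zero , b) ]

  edgesOf : ∀ {n m} → PInjRaw n m → List (Edge n m)
  edgesOf [] = []
  edgesOf (x ∷ p) = headEdges x ++ map shiftEdge (edgesOf p)

  edgesOf-mem⇒ : ∀ {n m} (p : PInjRaw n m) {a b} → (a , b) ∈ₗ edgesOf p → lookup p a ≡ just b
  edgesOf-mem⇒ (x ∷ p) {a} {b} mem with ∈-++⁻ (headEdges x) mem
  edgesOf-mem⇒ (just b' ∷ p) {.zero} {.b'} mem | inj₁ (here refl) = refl
  edgesOf-mem⇒ (nothing ∷ p) mem | inj₁ ()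
  edgesOf-mem⇒ (x ∷ p) {a} {b} mem | inj₂ m' with ∈-map⁻ shiftEdge m'
  ... | (a' , b') , m'' , refl = edgesOf-mem⇒ p m''

  edgesOf-mem⇐ : ∀ {n m} (p : PInjRaw n m) {a b} → lookup p a ≡ just b → (a , b) ∈ₗ edgesOf p
  edgesOf-mem⇐ (just b ∷ p) {zero} refl = here refl
  edgesOf-mem⇐ (nothing ∷ p) {zero} ()
  edgesOf-mem⇐ (x ∷ p) {suc a} e = ∈-++⁺ʳ (headEdges x) (∈-map⁺ shiftEdge (edgesOf-mem⇐ p e))

  shiftEdge-injective : ∀ {n m} {x y : Edge n m} → shiftEdge x ≡ shiftEdge y → x ≡ y
  shiftEdge-injective {x = a , b} {a' , b'} e = cong₂ _,_ (suc-injective (cong proj₁ e)) (cong proj₂ e)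

  edgesOf-unique : ∀ {n m} (p : PInjRaw n m) → Unique (edgesOf p)
  edgesOf-unique [] = []
  edgesOf-unique (nothing ∷ p) = UP.map⁺ shiftEdge-injective (edgesOf-unique p)
  edgesOf-unique (just b ∷ p) = All.tabulate (λ m → λ e → nz m e) ∷ UP.map⁺ shiftEdge-injective (edgesOf-unique p)
    where
    nz : ∀ {y} → y ∈ₗ map shiftEdge (edgesOf p) → (zero , b) ≡ y → ⊥
    nz m refl with ∈-map⁻ shiftEdge m
    ... | (a , b') , _ , ()

  edgesOf-disjoint : ∀ {n m} (p : PInjRaw n m) → InjectiveTable p → AllPairs VertexDisjoint (edgesOf p)
  edgesOf-disjoint p inj = unique⇒AllPairs (edgesOf-unique p) h
    where
    h : ∀ {x y} → x ∈ₗ edgesOf p → y ∈ₗ edgesOf p → x ≢ y → VertexDisjoint x y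
    h {a , b} {a' , b'} mx my ne =
      (λ { refl → ne (cong (a ,_) (just-injective (trans (sym (edgesOf-mem⇒ p mx)) (edgesOf-mem⇒ p my)))) }) ,
      (λ { refl → ne (cong (_, b) (inj a a' b (edgesOf-mem⇒ p mx) (edgesOf-mem⇒ p my))) })

  edgesOf-length : ∀ {n m} (p : PInjRaw n m) → length (edgesOf p) + count (unmatched p) ≡ n
  edgesOf-length [] = refl
  edgesOf-length (nothing ∷ p) = trans (cong (_+ suc (count (unmatched p))) (length-map shiftEdge (edgesOf p)))
                                (trans (+-suc (length (edgesOf p)) _) (cong suc (edgesOf-length p)))
  edgesOf-length (just b ∷ p) =
      cong suc (trans (cong (_+ count (unmatched p)) (length-map shiftEdge (edgesOf p))) (edgesOf-length p))

  tableOf : ∀ {n m} → List (Edge n m) → PInjRaw n m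
  tableOf es = tabulate (λ i → partner i es)

  maybe-ext : ∀ {A : Set} (u v : Maybe A) → (∀ b → u ≡ just b → v ≡ just b) → (∀ b → v ≡ just b → u ≡ just b) → u ≡ v
  maybe-ext (just x) v f g = sym (f x refl)
  maybe-ext nothing (just y) f g = g y refl
  maybe-ext nothing nothing f g = refl

  tableOf-edgesOf : ∀ {n m} (p : PInjRaw n m) → InjectiveTable p → tableOf (edgesOf p) ≡ p
  tableOf-edgesOf p inj = vec-ext (λ a → trans (lookup∘tabulate _ a) (maybe-ext _ _
    (λ b e → edgesOf-mem⇒ p (partner-sound a (edgesOf p) e))
    (λ b e → partner-complete a (edgesOf p) (edgesOf-disjoint p inj) (edgesOf-mem⇐ p e))))

  tableOf-mem : ∀ {n m} (es : List (Edge n m)) → AllPairs VertexDisjoint es → ∀ {a b} →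
    ((a , b) ∈ₗ es → lookup (tableOf es) a ≡ just b) × (lookup (tableOf es) a ≡ just b → (a , b) ∈ₗ es)
  tableOf-mem es ap {a} {b} = (λ m → trans (lookup∘tabulate _ a) (partner-complete a es ap m)) ,
      (λ e → partner-sound a es (trans (sym (lookup∘tabulate _ a)) e))

  tableOf-injective : ∀ {n m} (es : List (Edge n m)) → AllPairs VertexDisjoint es → InjectiveTable (tableOf es)
  tableOf-injective es ap i j r ei ej =
      cong proj₁ (disjoint-same-right ap (proj₂ (tableOf-mem es ap) ei) (proj₂ (tableOf-mem es ap) ej) refl)

  edgesOf-tableOf : ∀ {n m} (es : List (Edge n m)) → AllPairs VertexDisjoint es → edgesOf (tableOf es) ↭ es
  edgesOf-tableOf es ap = same-elements⇒↭ (edgesOf-unique (tableOf es)) (disjoint⇒unique ap)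
    (λ { {a , b} m → proj₂ (tableOf-mem es ap) (edgesOf-mem⇒ (tableOf es) m) })
    (λ { {a , b} m → edgesOf-mem⇐ (tableOf es) (proj₁ (tableOf-mem es ap) m) })

  tableOf-cong : ∀ {n m} (es es' : List (Edge n m)) → AllPairs VertexDisjoint es → AllPairs VertexDisjoint es' →
      es ↭ es' → tableOf es ≡ tableOf es'
  tableOf-cong es es' ap ap' pm = vec-ext (λ a → maybe-ext _ _
    (λ b e → proj₁ (tableOf-mem es' ap') (∈-resp-↭ pm (proj₂ (tableOf-mem es ap) e)))
    (λ b e → proj₁ (tableOf-mem es ap) (∈-resp-↭ (↭-sym pm) (proj₂ (tableOf-mem es' ap') e))))

  module _ {n m k : ℕ} where
    open IsMatching
    open IsPInj

    matching⇒pinj : MatchC n m k → PInjC n m k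
    matching⇒pinj (es , e , ek , im) = tableOf es , mkPInj (tableOf-injective es (disjoint im)) cntEq
      where
      lenEq : length (edgesOf (tableOf es)) ≡ e
      lenEq = trans (↭-length (edgesOf-tableOf es (disjoint im))) (size im)
      cntEq : count (unmatched (tableOf es)) ≡ k
      cntEq = +-cancelˡ-≡ e _ _ (trans
          (trans (cong (_+ count (unmatched (tableOf es))) (sym lenEq)) (edgesOf-length (tableOf es))) (sym ek))

    pinj⇒matching : PInjC n m k → MatchC n m k
    pinj⇒matching (p , v) = edgesOf p , length (edgesOf p) ,
        trans (cong (length (edgesOf p) +_) (sym (unmatched-count v))) (edgesOf-length p) ,
                    isMatching (edgesOf-disjoint p (injective v)) refl

    matchings≅pinj : Match n m k ≅ PInj n m k
    matchings≅pinj = mk-iso {S = Match n m k} {T = PInj n m k} matching⇒pinj pinj⇒matching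
      (λ { {es , _ , _ , im} {es' , _ , _ , im'} pm → tableOf-cong es es' (disjoint im) (disjoint im') pm })
      (λ { {p , v} {p' , v'} refl → ↭-refl })
      (λ { (p , v) → tableOf-edgesOf p (injective v) })
      (λ { (es , _ , _ , im) → edgesOf-tableOf es (disjoint im) })

-- Matchings of K_{n,n+α} solve the recurrence with weight (α + 1) + n + k.
module MatchingCount where

  open Recurrence
  open PartialInjections

  -- The initial rows: no left vertices (any m), and K_{1,0}.
  pinj-base : ∀ c m k → PInj 0 m k ≅ Canon c 0 k
  pinj-base c m zero = mk-iso {S = PInj 0 m 0} {T = Canon c 0 0} (λ _ → tt) (λ _ → [] , mkPInj (λ ()) refl)
      (λ _ → refl) (λ _ → refl)
    (λ { tt → refl }) (λ { ([] , v) → refl })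
  pinj-base c m (suc k) = empty-iso {S = PInj 0 m (suc k)} {T = Canon c 0 (suc k)}
      (λ { ([] , v) → f (IsPInj.unmatched-count v) }) (λ ())
    where f : 0 ≡ suc k → ⊥
          f ()

  pinj-base₁ : ∀ k → PInj 1 0 k ≅ Canon 0 1 k
  pinj-base₁ zero = empty-iso {S = PInj 1 0 0} {T = Canon 0 1 0}
      (λ { ((nothing ∷ []) , v) → f (IsPInj.unmatched-count v) ; ((just () ∷ []) , v) }) g
    where f : 1 ≡ 0 → ⊥
          f ()
          g : Carrier (Canon 0 1 0) → ⊥
          g (inj₁ ())
          g (inj₂ (_ , ()))
  pinj-base₁ (suc zero) = mk-iso {S = PInj 1 0 1} {T = Canon 0 1 1} (λ _ → inj₁ tt)
      (λ _ → (nothing ∷ []) , mkPInj (λ { zero zero r _ _ → refl }) refl)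
    (λ _ → inj₁ refl) (λ _ → refl)
    (λ { (inj₁ tt) → inj₁ refl ; (inj₂ (() , _)) })
    (λ { ((nothing ∷ []) , v) → refl ; ((just () ∷ []) , v) })
  pinj-base₁ (suc (suc k)) =
      empty-iso {S = PInj 1 0 (suc (suc k))} {T = Canon 0 1 (suc (suc k))}
      (λ { ((nothing ∷ []) , v) → f (IsPInj.unmatched-count v) ; ((just () ∷ []) , v) }) g
    where f : 1 ≡ suc (suc k) → ⊥
          f ()
          g : Carrier (Canon 0 1 (suc (suc k))) → ⊥
          g (inj₁ ())
          g (inj₂ (() , _))

  -- Partial injections Fin n ⇀ Fin (n + d), i.e. α = d ≥ 0, and
  pinj-canon : ∀ d n k → PInj n (n + d) k ≅ Canon (suc d) n k
  pinj-canon d = recurrence-iso (λ n k → suc d + n + k) (λ n k → PInj n (n + d) k) (Canon (suc d)) sF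
      (canon-step (suc d)) (pinj-base (suc d) d)
    where
    sF : ∀ n k → PInj (suc n) (suc n + d) k ≅ Step (λ n k → suc d + n + k) (λ n k → PInj n (n + d) k) n k
    sF n k = pinj-step n (n + d) k ⊙
        (id-iso ⊎-inverse (id-iso ×-inverse fin-cast-iso (cong suc (cong (_+ k) (+-comm n d)))))

  -- Fin (n + 1) ⇀ Fin n, i.e. α = −1.
  pinj-canon₋₁ : ∀ n k → PInj (suc n) n k ≅ Canon 0 (suc n) k
  pinj-canon₋₁ = recurrence-iso (λ n k → 0 + suc n + k) (λ n k → PInj (suc n) n k) (λ n k → Canon 0 (suc n) k)
    (λ n k → pinj-step (suc n) n k) (λ n k → canon-step 0 (suc n) k) pinj-base₁

-- Words over Fin (n+1) and the surgery "delete the letter 0" / "insert a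
-- letter 0 next to selected letters", used to remove and reinsert the point 0
-- in the list part of an element of LC.
module WordSurgery where

  lowerWord : ∀ {n} → List (Fin (suc n)) → List (Fin n)
  lowerWord [] = []
  lowerWord (zero ∷ w) = lowerWord w
  lowerWord (suc i ∷ w) = i ∷ lowerWord w

  -- Shift letter v up, putting a new letter 0 before it (b = true) or after
  -- it (b = false) when v is selected.
  raiseLetter : ∀ {n} → Bool → Bool → Fin n → List (Fin (suc n)) → List (Fin (suc n))
  raiseLetter true true v r = zero ∷ suc v ∷ r
  raiseLetter true false v r = suc v ∷ zero ∷ r
  raiseLetter false b v r = suc v ∷ r

  raiseWord : ∀ {n} → (Fin n → Bool) → Bool → List (Fin n) → List (Fin (suc n))
  raiseWord t b [] = []
  raiseWord t b (v ∷ w) = raiseLetter (t v) b v (raiseWord t b w)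

  dropEmpty : ∀ {A : Set} → List (List A) → List (List A)
  dropEmpty [] = []
  dropEmpty ([] ∷ ws) = dropEmpty ws
  dropEmpty ((x ∷ w) ∷ ws) = (x ∷ w) ∷ dropEmpty ws

  lowerSystem : ∀ {n} → List (List (Fin (suc n))) → List (List (Fin n))
  lowerSystem λs = dropEmpty (map lowerWord λs)

  lower-++ : ∀ {n} (u v : List (Fin (suc n))) → lowerWord (u ++ v) ≡ lowerWord u ++ lowerWord v
  lower-++ [] v = refl
  lower-++ (zero ∷ u) v = lower-++ u v
  lower-++ (suc i ∷ u) v = cong (i ∷_) (lower-++ u v)

  raise-++ : ∀ {n} t b (u v : List (Fin n)) → raiseWord t b (u ++ v) ≡ raiseWord t b u ++ raiseWord t b v
  raise-++ t b [] v = refl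
  raise-++ t b (x ∷ u) v with t x | b
  ... | true | true = cong (λ r → zero ∷ suc x ∷ r) (raise-++ t _ u v)
  ... | true | false = cong (λ r → suc x ∷ zero ∷ r) (raise-++ t _ u v)
  ... | false | _ = cong (suc x ∷_) (raise-++ t _ u v)

  lower-raise : ∀ {n} t b (w : List (Fin n)) → lowerWord (raiseWord t b w) ≡ w
  lower-raise t b [] = refl
  lower-raise t b (v ∷ w) with t v | b
  ... | true | true = cong (v ∷_) (lower-raise t _ w)
  ... | true | false = cong (v ∷_) (lower-raise t _ w)
  ... | false | _ = cong (v ∷_) (lower-raise t _ w)

  raise-lower : ∀ {n} t b (w : List (Fin (suc n))) → zero ∉ₗ w → (∀ v → suc v ∈ₗ w → t v ≡ false) →
      raiseWord t b (lowerWord w) ≡ w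
  raise-lower t b [] h1 h2 = refl
  raise-lower t b (zero ∷ w) h1 h2 = ⊥-elim (h1 (here refl))
  raise-lower t b (suc i ∷ w) h1 h2 with t i in e
  ... | true = ⊥-elim (false≢true (trans (sym (h2 i (here refl))) e))
  ... | false = cong (suc i ∷_) (raise-lower t b w (λ m → h1 (there m)) (λ v m → h2 v (there m)))

  concat-map-lower : ∀ {n} (L : List (List (Fin (suc n)))) → concat (map lowerWord L) ≡ lowerWord (concat L)
  concat-map-lower [] = refl
  concat-map-lower (w ∷ L) = trans (cong (lowerWord w ++_) (concat-map-lower L)) (sym (lower-++ w (concat L)))

  concat-map-raise : ∀ {n} t b (L : List (List (Fin n))) → concat (map (raiseWord t b) L) ≡ raiseWord t b (concat L)
  concat-map-raise t b [] = refl
  concat-map-raise t b (w ∷ L) =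
      trans (cong (raiseWord t b w ++_) (concat-map-raise t b L)) (sym (raise-++ t b w (concat L)))

  concat-dropEmpty : ∀ {A : Set} (L : List (List A)) → concat (dropEmpty L) ≡ concat L
  concat-dropEmpty [] = refl
  concat-dropEmpty ([] ∷ L) = concat-dropEmpty L
  concat-dropEmpty ((x ∷ w) ∷ L) = cong ((x ∷ w) ++_) (concat-dropEmpty L)

  dropEmpty-ne : ∀ {A : Set} (L : List (List A)) → All (λ w → w ≢ []) (dropEmpty L)
  dropEmpty-ne [] = []
  dropEmpty-ne ([] ∷ L) = dropEmpty-ne L
  dropEmpty-ne ((x ∷ w) ∷ L) = (λ ()) ∷ dropEmpty-ne L

  dropEmpty-id : ∀ {A : Set} (L : List (List A)) → All (λ w → w ≢ []) L → dropEmpty L ≡ L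
  dropEmpty-id [] a = refl
  dropEmpty-id ([] ∷ L) (p ∷ a) = ⊥-elim (p refl)
  dropEmpty-id ((x ∷ w) ∷ L) (p ∷ a) = cong ((x ∷ w) ∷_) (dropEmpty-id L a)

  dropEmpty-++ : ∀ {A : Set} (L L' : List (List A)) → dropEmpty (L ++ L') ≡ dropEmpty L ++ dropEmpty L'
  dropEmpty-++ [] L' = refl
  dropEmpty-++ ([] ∷ L) L' = dropEmpty-++ L L'
  dropEmpty-++ ((x ∷ w) ∷ L) L' = cong ((x ∷ w) ∷_) (dropEmpty-++ L L')

  dropEmpty-↭ : ∀ {A : Set} {L L' : List (List A)} → L ↭ L' → dropEmpty L ↭ dropEmpty L'
  dropEmpty-↭ Perm.refl = ↭-refl
  dropEmpty-↭ (Perm.prep [] p) = dropEmpty-↭ p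
  dropEmpty-↭ (Perm.prep (x ∷ w) p) = ↭-prep _ (dropEmpty-↭ p)
  dropEmpty-↭ (Perm.swap [] [] p) = dropEmpty-↭ p
  dropEmpty-↭ (Perm.swap [] (y ∷ w') p) = ↭-prep _ (dropEmpty-↭ p)
  dropEmpty-↭ (Perm.swap (x ∷ w) [] p) = ↭-prep _ (dropEmpty-↭ p)
  dropEmpty-↭ (Perm.swap (x ∷ w) (y ∷ w') p) = ↭-swap _ _ (dropEmpty-↭ p)
  dropEmpty-↭ (Perm.trans p q) = ↭-trans (dropEmpty-↭ p) (dropEmpty-↭ q)

  raise-nonempty : ∀ {n} t b (w : List (Fin n)) → w ≢ [] → raiseWord t b w ≢ []
  raise-nonempty t b [] h = ⊥-elim (h refl)
  raise-nonempty t b (v ∷ w) h with t v | b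
  ... | true | true = λ ()
  ... | true | false = λ ()
  ... | false | _ = λ ()

  raise-not-singleton : ∀ {n} t b (w : List (Fin n)) → w ≢ [] → raiseWord t b w ≢ zero ∷ []
  raise-not-singleton t b [] h = ⊥-elim (h refl)
  raise-not-singleton t b (v ∷ w) h with t v | b
  ... | true | true = λ ()
  ... | true | false = λ ()
  ... | false | _ = λ ()

  mem-lower⇒ : ∀ {n} (w : List (Fin (suc n))) {v} → v ∈ₗ lowerWord w → suc v ∈ₗ w
  mem-lower⇒ (zero ∷ w) m = there (mem-lower⇒ w m)
  mem-lower⇒ (suc i ∷ w) (here refl) = here refl
  mem-lower⇒ (suc i ∷ w) (there m) = there (mem-lower⇒ w m)

  mem-lower⇐ : ∀ {n} (w : List (Fin (suc n))) {v} → suc v ∈ₗ w → v ∈ₗ lowerWord w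
  mem-lower⇐ (zero ∷ w) (here ())
  mem-lower⇐ (zero ∷ w) (there m) = mem-lower⇐ w m
  mem-lower⇐ (suc i ∷ w) (here refl) = here refl
  mem-lower⇐ (suc i ∷ w) (there m) = there (mem-lower⇐ w m)

  mem-raise-suc⇒ : ∀ {n} t b (w : List (Fin n)) {v} → suc v ∈ₗ raiseWord t b w → v ∈ₗ w
  mem-raise-suc⇒ t b (x ∷ w) m with t x | b
  mem-raise-suc⇒ t b (x ∷ w) (here ()) | true | true
  mem-raise-suc⇒ t b (x ∷ w) (there (here refl)) | true | true = here refl
  mem-raise-suc⇒ t b (x ∷ w) (there (there m)) | true | true = there (mem-raise-suc⇒ t _ w m)
  mem-raise-suc⇒ t b (x ∷ w) (here refl) | true | false = here refl
  mem-raise-suc⇒ t b (x ∷ w) (there (here ())) | true | false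
  mem-raise-suc⇒ t b (x ∷ w) (there (there m)) | true | false = there (mem-raise-suc⇒ t _ w m)
  mem-raise-suc⇒ t b (x ∷ w) (here refl) | false | _ = here refl
  mem-raise-suc⇒ t b (x ∷ w) (there m) | false | _ = there (mem-raise-suc⇒ t _ w m)

  mem-raise-suc⇐ : ∀ {n} t b (w : List (Fin n)) {v} → v ∈ₗ w → suc v ∈ₗ raiseWord t b w
  mem-raise-suc⇐ t b (x ∷ w) m with t x | b
  mem-raise-suc⇐ t b (x ∷ w) (here refl) | true | true = there (here refl)
  mem-raise-suc⇐ t b (x ∷ w) (there m) | true | true = there (there (mem-raise-suc⇐ t _ w m))
  mem-raise-suc⇐ t b (x ∷ w) (here refl) | true | false = here refl
  mem-raise-suc⇐ t b (x ∷ w) (there m) | true | false = there (there (mem-raise-suc⇐ t _ w m))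
  mem-raise-suc⇐ t b (x ∷ w) (here refl) | false | _ = here refl
  mem-raise-suc⇐ t b (x ∷ w) (there m) | false | _ = there (mem-raise-suc⇐ t _ w m)

  mem-raise-zero⇒ : ∀ {n} t b (w : List (Fin n)) → zero ∈ₗ raiseWord t b w → ∃ λ v → v ∈ₗ w × t v ≡ true
  mem-raise-zero⇒ t b (x ∷ w) m with t x in e
  ... | true = x , here refl , e
  mem-raise-zero⇒ t b (x ∷ w) (here ()) | false
  mem-raise-zero⇒ t b (x ∷ w) (there m) | false with mem-raise-zero⇒ t b w m
  ... | v , mv , tv = v , there mv , tv

  mem-raise-zero⇐ : ∀ {n} t b (w : List (Fin n)) {v} → v ∈ₗ w → t v ≡ true → zero ∈ₗ raiseWord t b w
  mem-raise-zero⇐ t b (x ∷ w) m tv with t x in e | b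
  mem-raise-zero⇐ t b (x ∷ w) m tv | true | true = here refl
  mem-raise-zero⇐ t b (x ∷ w) m tv | true | false = there (here refl)
  mem-raise-zero⇐ t b (x ∷ w) (here refl) tv | false | _ = ⊥-elim (false≢true (trans (sym e) tv))
  mem-raise-zero⇐ t b (x ∷ w) (there m) tv | false | _ = there (mem-raise-zero⇐ t _ w m tv)

  unique-lower : ∀ {n} (w : List (Fin (suc n))) → Unique w → Unique (lowerWord w)
  unique-lower [] u = []
  unique-lower (zero ∷ w) (p ∷ u) = unique-lower w u
  unique-lower (suc i ∷ w) (p ∷ u) = ¬Any⇒All¬ _ (λ m → All¬⇒¬Any p (mem-lower⇒ w m)) ∷ unique-lower w u

  unique-raise : ∀ {n} t b (w : List (Fin n)) → Unique w →
      (∀ {v v'} → v ∈ₗ w → v' ∈ₗ w → t v ≡ true → t v' ≡ true → v ≡ v') → Unique (raiseWord t b w)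
  unique-raise t b [] u h = []
  unique-raise t b (x ∷ w) (p ∷ u) h with t x in e | b
  ... | true | true = ¬Any⇒All¬ _ z∉ ∷ ¬Any⇒All¬ _
      (λ m → All¬⇒¬Any p (mem-raise-suc⇒ t _ w m)) ∷ unique-raise t _ w u (λ mv mv' → h (there mv) (there mv'))
    where
    z∉ : zero ∉ₗ suc x ∷ raiseWord t true w
    z∉ (here ())
    z∉ (there m) with mem-raise-zero⇒ t true w m
    ... | v , mv , tv = All¬⇒¬Any p (subst (_∈ₗ w) (sym (h (here refl) (there mv) e tv)) mv)
  ... | true | false = ¬Any⇒All¬ _
      (λ { (here ()) ; (there m) → All¬⇒¬Any p (mem-raise-suc⇒ t _ w m) }) ∷ ¬Any⇒All¬ _ z∉ ∷ unique-raise t _ w u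
      (λ mv mv' → h (there mv) (there mv'))
    where
    z∉ : zero ∉ₗ raiseWord t false w
    z∉ m with mem-raise-zero⇒ t false w m
    ... | v , mv , tv = All¬⇒¬Any p (subst (_∈ₗ w) (sym (h (here refl) (there mv) e tv)) mv)
  ... | false | _ = ¬Any⇒All¬ _ (λ m → All¬⇒¬Any p (mem-raise-suc⇒ t _ w m)) ∷ unique-raise t _ w u
      (λ mv mv' → h (there mv) (there mv'))

module WordFacts where

  open WordSurgery

  data Adj {A : Set} (a b : A) : List A → Set where
    ah : ∀ {w} → Adj a b (a ∷ b ∷ w)
    at : ∀ {x w} → Adj a b w → Adj a b (x ∷ w)

  adj? : ∀ {n} (a b : Fin n) w → Dec (Adj a b w)
  adj? a b [] = no λ ()
  adj? a b (x ∷ []) = no (λ { (at ()) })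
  adj? a b (x ∷ y ∷ w) with adj? a b (y ∷ w)
  ... | yes p = yes (at p)
  ... | no np with a ≟F x | b ≟F y
  ... | yes refl | yes refl = yes ah
  ... | no ne | _ = no (λ { ah → ne refl ; (at p) → np p })
  ... | yes _ | no ne = no (λ { ah → ne refl ; (at p) → np p })

  adj-split : ∀ {A : Set} {a b : A} {w} → Adj a b w → ∃₂ λ u v → w ≡ u ++ a ∷ b ∷ v
  adj-split ah = [] , _ , refl
  adj-split (at {x} p) with adj-split p
  ... | u , v , refl = x ∷ u , v , refl

  adj-++ : ∀ {A : Set} (u : List A) {a b v} → Adj a b (u ++ a ∷ b ∷ v)
  adj-++ [] = ah
  adj-++ (x ∷ u) = at (adj-++ u)

  adj-mem₁ : ∀ {A : Set} {a b : A} {w} → Adj a b w → a ∈ₗ w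
  adj-mem₁ ah = here refl
  adj-mem₁ (at p) = there (adj-mem₁ p)

  adj-mem₂ : ∀ {A : Set} {a b : A} {w} → Adj a b w → b ∈ₗ w
  adj-mem₂ ah = there (here refl)
  adj-mem₂ (at p) = there (adj-mem₂ p)

  any-split : ∀ {A : Set} {P : A → Set} {L} → Any P L → ∃₂ λ pre post → ∃ λ w → L ≡ pre ++ w ∷ post × P w
  any-split (here p) = [] , _ , _ , refl , p
  any-split (there {x} a) with any-split a
  ... | pre , post , w , refl , p = x ∷ pre , post , w , refl , p

  raise-after-head : ∀ {n} t (w : List (Fin n)) {r} → raiseWord t false w ≡ zero ∷ r → ⊥
  raise-after-head t (v ∷ w) e with t v
  raise-after-head t (v ∷ w) () | true
  raise-after-head t (v ∷ w) () | false

  adj-raise-after : ∀ {n} t (w : List (Fin n)) {v} → t v ≡ true → v ∈ₗ w → Adj (suc v) zero (raiseWord t false w)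
  adj-raise-after t (x ∷ w) tv (here refl) rewrite tv = ah
  adj-raise-after t (x ∷ w) tv (there m) with t x
  ... | true = at (at (adj-raise-after t w tv m))
  ... | false = at (adj-raise-after t w tv m)

  adj-raise-after⁻ : ∀ {n} t (w : List (Fin n)) {y} → Adj (suc y) zero (raiseWord t false w) → t y ≡ true
  adj-raise-after⁻ t (x ∷ w) p with t x in e
  adj-raise-after⁻ t (x ∷ w) ah | true = e
  adj-raise-after⁻ t (x ∷ w) (at (at p)) | true = adj-raise-after⁻ t w p
  adj-raise-after⁻ t (x ∷ w) p | false with raiseWord t false w in e2
  adj-raise-after⁻ t (x ∷ w) ah | false | .zero ∷ _ = ⊥-elim (raise-after-head t w e2)
  adj-raise-after⁻ t (x ∷ w) (at p) | false | r = adj-raise-after⁻ t w (subst (Adj _ _) (sym e2) p)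

  adj-raise-before : ∀ {n} t (w : List (Fin n)) {v} → t v ≡ true → v ∈ₗ w → Adj zero (suc v) (raiseWord t true w)
  adj-raise-before t (x ∷ w) tv (here refl) rewrite tv = ah
  adj-raise-before t (x ∷ w) tv (there m) with t x
  ... | true = at (at (adj-raise-before t w tv m))
  ... | false = at (adj-raise-before t w tv m)

  adj-raise-before⁻ : ∀ {n} t (w : List (Fin n)) {h} → Adj zero (suc h) (raiseWord t true w) → t h ≡ true
  adj-raise-before⁻ t (x ∷ w) p with t x in e
  adj-raise-before⁻ t (x ∷ w) ah | true = e
  adj-raise-before⁻ t (x ∷ w) (at (at p)) | true = adj-raise-before⁻ t w p
  adj-raise-before⁻ t (x ∷ w) (at p) | false = adj-raise-before⁻ t w p

  raise-before-head : ∀ {n} t (w : List (Fin n)) {r} → raiseWord t true w ≡ zero ∷ r → ∃₂ λ v w' → w ≡ v ∷ w' ×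
      t v ≡ true
  raise-before-head t (v ∷ w) e with t v in tv
  raise-before-head t (v ∷ w) refl | true = v , w , refl , tv
  raise-before-head t (v ∷ w) () | false

  adj-raise-pred⁻ : ∀ {n} t (w : List (Fin n)) {y} → Adj (suc y) zero (raiseWord t true w) → ∃ λ v → t v ≡ true ×
      Adj y v w
  adj-raise-pred⁻ t (x ∷ w) p with t x in e
  adj-raise-pred⁻ t (x ∷ w) (at p) | true with raiseWord t true w in e2
  adj-raise-pred⁻ t (x ∷ w) (at ah) | true | .zero ∷ _ with raise-before-head t w e2
  ... | v , w' , refl , tv = v , tv , ah
  adj-raise-pred⁻ t (x ∷ w) (at (at p)) | true | r with adj-raise-pred⁻ t w (subst (Adj _ _) (sym e2) p)
  ... | v , tv , q = v , tv , at q
  adj-raise-pred⁻ t (x ∷ w) p | false with raiseWord t true w in e2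
  adj-raise-pred⁻ t (x ∷ w) ah | false | .zero ∷ _ with raise-before-head t w e2
  ... | v , w' , refl , tv = v , tv , ah
  adj-raise-pred⁻ t (x ∷ w) (at p) | false | r with adj-raise-pred⁻ t w (subst (Adj _ _) (sym e2) p)
  ... | v , tv , q = v , tv , at q

  uniq-++ˡ : ∀ {A : Set} (xs : List A) {ys a} → Unique (xs ++ ys) → a ∈ₗ xs → a ∉ₗ ys
  uniq-++ˡ (x ∷ xs) (p ∷ u) (here refl) m = All¬⇒¬Any p (∈-++⁺ʳ xs m)
  uniq-++ˡ (x ∷ xs) (p ∷ u) (there mx) m = uniq-++ˡ xs u mx m

  uniq-++ʳ : ∀ {A : Set} (xs : List A) {ys a} → Unique (xs ++ ys) → a ∈ₗ ys → a ∉ₗ xs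
  uniq-++ʳ xs u my mx = uniq-++ˡ xs u mx my

  uniq-++₁ : ∀ {A : Set} (xs : List A) {ys} → Unique (xs ++ ys) → Unique xs
  uniq-++₁ [] u = []
  uniq-++₁ (x ∷ xs) (p ∷ u) = ¬Any⇒All¬ _ (λ m → All¬⇒¬Any p (∈-++⁺ˡ m)) ∷ uniq-++₁ xs u

  uniq-++₂ : ∀ {A : Set} (xs : List A) {ys} → Unique (xs ++ ys) → Unique ys
  uniq-++₂ [] u = u
  uniq-++₂ (x ∷ xs) (p ∷ u) = uniq-++₂ xs u

  uniq-concat-mem : ∀ {A : Set} (L : List (List A)) {w} → Unique (concat L) → w ∈ₗ L → Unique w
  uniq-concat-mem (w ∷ L) u (here refl) = uniq-++₁ w u
  uniq-concat-mem (w ∷ L) u (there m) = uniq-concat-mem L (uniq-++₂ w u) m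

  uniq-concat-same : ∀ {A : Set} (L : List (List A)) {x w1 w2} → Unique (concat L) → x ∈ₗ w1 → w1 ∈ₗ L → x ∈ₗ w2 →
      w2 ∈ₗ L → w1 ≡ w2
  uniq-concat-same (w ∷ L) u x1 (here refl) x2 (here refl) = refl
  uniq-concat-same (w ∷ L) u x1 (here refl) x2 (there m2) = ⊥-elim (uniq-++ˡ w u x1 (∈-concat⁺′ x2 m2))
  uniq-concat-same (w ∷ L) u x1 (there m1) x2 (here refl) = ⊥-elim (uniq-++ˡ w u x2 (∈-concat⁺′ x1 m1))
  uniq-concat-same (w ∷ L) u x1 (there m1) x2 (there m2) = uniq-concat-same L (uniq-++₂ w u) x1 m1 x2 m2

  concat-split : ∀ {A : Set} (pre : List (List A)) w post → concat (pre ++ w ∷ post) ≡ concat pre ++ w ++ concat post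
  concat-split pre w post = sym (concat-++ pre (w ∷ post))

  lower-nonempty : ∀ {n} (w : List (Fin (suc n))) → w ≢ [] → Unique w → w ≢ zero ∷ [] → lowerWord w ≢ []
  lower-nonempty [] ne u ns = ⊥-elim (ne refl)
  lower-nonempty (suc i ∷ w) ne u ns = λ ()
  lower-nonempty (zero ∷ []) ne u ns = ⊥-elim (ns refl)
  lower-nonempty (zero ∷ zero ∷ w) ne ((p ∷ _) ∷ u) ns = ⊥-elim (p refl)
  lower-nonempty (zero ∷ suc i ∷ w) ne u ns = λ ()

  lower-nonempty′ : ∀ {n} (w : List (Fin (suc n))) → w ≢ [] → zero ∉ₗ w → lowerWord w ≢ []
  lower-nonempty′ [] ne z = ⊥-elim (ne refl)
  lower-nonempty′ (zero ∷ w) ne z = ⊥-elim (z (here refl))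
  lower-nonempty′ (suc i ∷ w) ne z = λ ()

  last-view : ∀ {A : Set} (u : List A) → u ≡ [] ⊎ ∃₂ λ u' a → u ≡ u' ++ a ∷ []
  last-view u with initLast u
  ... | [] = inj₁ refl
  ... | u' ∷ʳ′ a = inj₂ (u' , a , refl)

module ColouredPermutations where

  open Search

  ∈⇒ : ∀ {n} {x : Fin n} {A : Subset n} → x ∈ A → lookup A x ≡ true
  ∈⇒ = []=⇒lookup

  ⇒∈ : ∀ {n} {x : Fin n} {A : Subset n} → lookup A x ≡ true → x ∈ A
  ⇒∈ {A = A} = lookup⇒[]= _ A

  ∉⇒ : ∀ {n} {x : Fin n} {A : Subset n} → x ∉ A → lookup A x ≡ false
  ∉⇒ {x = x} {A} h with lookup A x in e
  ... | true = ⊥-elim (h (⇒∈ e))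
  ... | false = refl

  ⇒∉ : ∀ {n} {x : Fin n} {A : Subset n} → lookup A x ≡ false → x ∉ A
  ⇒∉ e m = false≢true (trans (sym e) (∈⇒ m))

  record IsColouredPerm (n c : ℕ) (A : Subset n) (σ : Vec (Fin n) n) (col : Vec (Maybe (Fin c)) n) : Set where
    constructor mkColouredPerm
    field
      s-inj : ∀ x y → lookup σ x ≡ lookup σ y → x ≡ y
      s-fix : ∀ x → x ∉ A → lookup σ x ≡ x
      c-on  : ∀ x → x ∈ A → ∃ λ (i : Fin c) → lookup col x ≡ just i
      c-off : ∀ x → x ∉ A → lookup col x ≡ nothing
      c-cyc : ∀ x → lookup col (lookup σ x) ≡ lookup col x
  open IsColouredPerm public

  isZ : ∀ {n} → Fin (suc n) → Bool
  isZ zero = true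
  isZ (suc _) = false

  -- For σ = s0 ∷ σt on Fin (n+1): the successor of y in the permutation
  -- with 0 cut out of its cycle (σ y, or σ 0 when σ y = 0).
  τ : ∀ {n} → Fin (suc n) → Vec (Fin (suc n)) n → Fin n → Fin (suc n)
  τ s0 σt y = if isZ (lookup σt y) then s0 else lookup σt y

  lowerOr : ∀ {n} → Fin n → Fin (suc n) → Fin n
  lowerOr y zero = y
  lowerOr y (suc j) = j

  removeFromPerm : ∀ {n} → Fin (suc n) → Vec (Fin (suc n)) n → Vec (Fin n) n
  removeFromPerm s0 σt = tabulate (λ y → lowerOr y (τ s0 σt y))

  bodyσ : ∀ {n} → (Fin n → Bool) → Vec (Fin n) n → Fin n → Fin (suc n)
  bodyσ t σ' y = if t y then zero else suc (lookup σ' y)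

  insertIntoPerm : ∀ {n} → Fin (suc n) → (Fin n → Bool) → Vec (Fin n) n → Vec (Fin (suc n)) (suc n)
  insertIntoPerm s0 t σ' = s0 ∷ tabulate (bodyσ t σ')

  module Removal {n c} (a0 : Bool) (A' : Subset n) (s0 : Fin (suc n)) (σt : Vec (Fin (suc n)) n)
             (c0 : Maybe (Fin c)) (colt : Vec (Maybe (Fin c)) n)
             (v : IsColouredPerm (suc n) c (a0 ∷ A') (s0 ∷ σt) (c0 ∷ colt)) where

    data Succ (y : Fin n) : Set where
      tz : lookup σt y ≡ zero → τ s0 σt y ≡ s0 → Succ y
      tn : ∀ j → lookup σt y ≡ suc j → τ s0 σt y ≡ suc j → Succ y

    succ-view : ∀ y → Succ y
    succ-view y with lookup σt y in e
    ... | zero = tz e (cong (λ u → if isZ u then s0 else u) e)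
    ... | suc j = tn j e (cong (λ u → if isZ u then s0 else u) e)

    τ≢0 : ∀ y → τ s0 σt y ≢ zero
    τ≢0 y h with succ-view y
    ... | tz e1 e2 = 0≢1+n (s-inj v zero (suc y) (trans (trans (sym e2) h) (sym e1)))
    ... | tn j e1 e2 = 0≢1+n (trans (sym h) e2)

    sucLower : ∀ y (u : Fin (suc n)) → u ≢ zero → suc (lowerOr y u) ≡ u
    sucLower y zero h = ⊥-elim (h refl)
    sucLower y (suc j) h = refl

    sucδ : ∀ y → suc (lookup (removeFromPerm s0 σt) y) ≡ τ s0 σt y
    sucδ y = trans (cong suc (lookup∘tabulate _ y)) (sucLower y _ (τ≢0 y))

    δ-inj : ∀ x y → lookup (removeFromPerm s0 σt) x ≡ lookup (removeFromPerm s0 σt) y → x ≡ y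
    δ-inj x y e with trans (sym (sucδ x)) (trans (cong suc e) (sucδ y))
    ... | ττ with succ-view x | succ-view y
    ... | tz a _ | tz b _ = suc-injective (s-inj v (suc x) (suc y) (trans a (sym b)))
    ... | tz a a' | tn j b b' = ⊥-elim (0≢1+n (s-inj v zero (suc y) (trans (sym a') (trans ττ (trans b' (sym b))))))
    ... | tn j a a' | tz b b' =
        ⊥-elim (0≢1+n (s-inj v zero (suc x) (trans (sym b') (trans (sym ττ) (trans a' (sym a))))))
    ... | tn j a a' | tn j' b b' =
        suc-injective (s-inj v (suc x) (suc y) (trans a (trans (sym a') (trans ττ (trans b' (sym b))))))

    δ-fix : ∀ x → x ∉ A' → lookup (removeFromPerm s0 σt) x ≡ x
    δ-fix x h with succ-view x
    ... | tz a _ = ⊥-elim (0≢1+n (trans (sym a) (s-fix v (suc x) (λ { (there m) → h m }))))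
    ... | tn j a a' = suc-injective
        (trans (sucδ x) (trans a' (trans (sym a) (s-fix v (suc x) (λ { (there m) → h m })))))

    δ-cyc : ∀ x → lookup colt (lookup (removeFromPerm s0 σt) x) ≡ lookup colt x
    δ-cyc x with succ-view x
    ... | tz a a' = trans (cong (lookup (c0 ∷ colt)) (trans (sucδ x) a'))
                     (trans (c-cyc v zero) (trans (cong (lookup (c0 ∷ colt)) (sym a)) (c-cyc v (suc x))))
    ... | tn j a a' = trans (cong (lookup (c0 ∷ colt)) (trans (sucδ x) a'))
                     (trans (cong (lookup (c0 ∷ colt)) (sym a)) (c-cyc v (suc x)))

    removed-valid : IsColouredPerm n c A' (removeFromPerm s0 σt) colt
    removed-valid = mkColouredPerm δ-inj δ-fix (λ x m → c-on v (suc x) (there m))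
        (λ x h → c-off v (suc x) (λ { (there m) → h m })) δ-cyc

    s0-off : a0 ≡ false → s0 ≡ zero
    s0-off e = s-fix v zero (λ m → false≢true (trans (sym e) (∈⇒ m)))

    s0-in : ∀ z → s0 ≡ suc z → lookup A' z ≡ true
    s0-in z e with lookup A' z in eA
    ... | true = refl
    ... | false = ⊥-elim (0≢1+n
        (s-inj v zero (suc z) (trans e (sym (s-fix v (suc z) (λ { (there m) → false≢true (trans (sym eA) (∈⇒ m)) }))))))

    σt≢0 : s0 ≡ zero → ∀ y → lookup σt y ≢ zero
    σt≢0 e y h = 0≢1+n (s-inj v zero (suc y) (trans e (sym h)))

  -- Validity of insertIntoPerm: as a new fixed point (with colour c0 or outside A),
  -- or inserted into the cycle of z just before z.
  module Insertion {n c} (A' : Subset n) (σ' : Vec (Fin n) n) (col' : Vec (Maybe (Fin c)) n)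
      (v : IsColouredPerm n c A' σ' col') where

    fixed-valid : ∀ (a0 : Bool) (c0 : Maybe (Fin c)) → (a0 ≡ true → ∃ λ i → c0 ≡ just i) → (a0 ≡ false → c0 ≡ nothing) →
            IsColouredPerm (suc n) c (a0 ∷ A') (insertIntoPerm zero (λ _ → false) σ') (c0 ∷ col')
    fixed-valid a0 c0 h1 h2 = mkColouredPerm inj fix on off cyc
      where
      e : ∀ y → lookup (insertIntoPerm zero (λ _ → false) σ') (suc y) ≡ suc (lookup σ' y)
      e y = lookup∘tabulate (bodyσ (λ _ → false) σ') y
      inj : ∀ x y → lookup (insertIntoPerm zero (λ _ → false) σ') x ≡ lookup
          (insertIntoPerm zero (λ _ → false) σ') y → x ≡ y
      inj zero zero q = refl
      inj zero (suc y) q = ⊥-elim (0≢1+n (trans q (e y)))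
      inj (suc x) zero q = ⊥-elim (0≢1+n (trans (sym q) (e x)))
      inj (suc x) (suc y) q = cong suc (s-inj v x y (suc-injective (trans (sym (e x)) (trans q (e y)))))
      fix : ∀ x → x ∉ (a0 ∷ A') → lookup (insertIntoPerm zero (λ _ → false) σ') x ≡ x
      fix zero h = refl
      fix (suc x) h = trans (e x) (cong suc (s-fix v x (λ m → h (there m))))
      on : ∀ x → x ∈ (a0 ∷ A') → ∃ λ i → lookup (c0 ∷ col') x ≡ just i
      on zero m = h1 (∈⇒ m)
      on (suc x) (there m) = c-on v x m
      off : ∀ x → x ∉ (a0 ∷ A') → lookup (c0 ∷ col') x ≡ nothing
      off zero h = h2 (∉⇒ h)
      off (suc x) h = c-off v x (λ m → h (there m))
      cyc : ∀ x → lookup (c0 ∷ col') (lookup (insertIntoPerm zero (λ _ → false) σ') x) ≡ lookup (c0 ∷ col') x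
      cyc zero = refl
      cyc (suc x) = trans (cong (lookup (c0 ∷ col')) (e x)) (c-cyc v x)

    module IntoCycle (z : Fin n) (zA : lookup A' z ≡ true) where
      t : Fin n → Bool
      t y = does (lookup σ' y ≟F z)

      cycle-valid : IsColouredPerm (suc n) c (true ∷ A') (insertIntoPerm (suc z) t σ') (lookup col' z ∷ col')
      cycle-valid = mkColouredPerm inj fix on off cyc
        where
        eT : ∀ y → t y ≡ true → lookup (insertIntoPerm (suc z) t σ') (suc y) ≡ zero
        eT y ty = trans (lookup∘tabulate (bodyσ t σ') y) (cong (λ b → if b then zero else suc (lookup σ' y)) ty)
        eF : ∀ y → t y ≡ false → lookup (insertIntoPerm (suc z) t σ') (suc y) ≡ suc (lookup σ' y)
        eF y ty = trans (lookup∘tabulate (bodyσ t σ') y) (cong (λ b → if b then zero else suc (lookup σ' y)) ty)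
        side : ∀ y → suc z ≡ lookup (insertIntoPerm (suc z) t σ') (suc y) → ⊥
        side y q with t y in ty
        ... | true = 0≢1+n (sym (trans q (eT y ty)))
        ... | false = false≢true (trans (sym ty)
            (trans (cong (λ u → does (u ≟F z)) (sym (suc-injective (trans q (eF y ty))))) (dEq z)))
        inj : ∀ x y → lookup (insertIntoPerm (suc z) t σ') x ≡ lookup (insertIntoPerm (suc z) t σ') y → x ≡ y
        inj zero zero q = refl
        inj zero (suc y) q = ⊥-elim (side y q)
        inj (suc x) zero q = ⊥-elim (side x (sym q))
        inj (suc x) (suc y) q with t x in tx | t y in ty
        ... | true | true = cong suc (s-inj v x y (trans (dTrue _ _ tx) (sym (dTrue _ _ ty))))
        ... | true | false = ⊥-elim (0≢1+n (trans (sym (eT x tx)) (trans q (eF y ty))))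
        ... | false | true = ⊥-elim (0≢1+n (trans (sym (eT y ty)) (trans (sym q) (eF x tx))))
        ... | false | false = cong suc (s-inj v x y (suc-injective (trans (sym (eF x tx)) (trans q (eF y ty)))))
        fix : ∀ x → x ∉ (true ∷ A') → lookup (insertIntoPerm (suc z) t σ') x ≡ x
        fix zero h = ⊥-elim (h here)
        fix (suc x) h with t x in tx
        ... | true = ⊥-elim (h (there
            (subst (λ u → u ∈ A') (trans (sym (dTrue _ _ tx)) (s-fix v x (λ m → h (there m)))) (⇒∈ zA))))
        ... | false = trans (eF x tx) (cong suc (s-fix v x (λ m → h (there m))))
        on : ∀ x → x ∈ (true ∷ A') → ∃ λ i → lookup (lookup col' z ∷ col') x ≡ just i
        on zero m = c-on v z (⇒∈ zA)
        on (suc x) (there m) = c-on v x m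
        off : ∀ x → x ∉ (true ∷ A') → lookup (lookup col' z ∷ col') x ≡ nothing
        off zero h = ⊥-elim (h here)
        off (suc x) h = c-off v x (λ m → h (there m))
        cyc : ∀ x → lookup (lookup col' z ∷ col') (lookup (insertIntoPerm (suc z) t σ') x) ≡ lookup
            (lookup col' z ∷ col') x
        cyc zero = refl
        cyc (suc x) with t x in tx
        ... | true = trans (cong (lookup (lookup col' z ∷ col')) (eT x tx))
            (trans (cong (lookup col') (sym (dTrue _ _ tx))) (c-cyc v x))
        ... | false = trans (cong (lookup (lookup col' z ∷ col')) (eF x tx)) (c-cyc v x)

  remove-insertIntoPerm : ∀ {n} (s0 : Fin (suc n)) (t : Fin n → Bool) (σ' : Vec (Fin n) n) →
    (∀ y → t y ≡ true → lowerOr y s0 ≡ lookup σ' y) → removeFromPerm s0 (tabulate (bodyσ t σ')) ≡ σ'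
  remove-insertIntoPerm s0 t σ' h = vec-ext (λ y → trans (lookup∘tabulate _ y) (go y))
    where
    go : ∀ y → lowerOr y (τ s0 (tabulate (bodyσ t σ')) y) ≡ lookup σ' y
    go y with t y in ty
    ... | true = trans (cong (λ u → lowerOr y (if isZ u then s0 else u))
        (trans (lookup∘tabulate (bodyσ t σ') y) (cong (λ b → if b then zero else suc (lookup σ' y)) ty))) (h y ty)
    ... | false = cong (λ u → lowerOr y (if isZ u then s0 else u))
        (trans (lookup∘tabulate (bodyσ t σ') y) (cong (λ b → if b then zero else suc (lookup σ' y)) ty))

  module RemovalLaws {n c} (a0 : Bool) (A' : Subset n) (s0 : Fin (suc n)) (σt : Vec (Fin (suc n)) n)
             (c0 : Maybe (Fin c)) (colt : Vec (Maybe (Fin c)) n)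
             (v : IsColouredPerm (suc n) c (a0 ∷ A') (s0 ∷ σt) (c0 ∷ colt)) where
    open Removal a0 A' s0 σt c0 colt v

    insert-remove-fixed : s0 ≡ zero → tabulate (bodyσ (λ _ → false) (removeFromPerm s0 σt)) ≡ σt
    insert-remove-fixed e = vec-ext
        (λ y → trans (lookup∘tabulate (bodyσ (λ _ → false) (removeFromPerm s0 σt)) y) (go y))
      where
      go : ∀ y → suc (lookup (removeFromPerm s0 σt) y) ≡ lookup σt y
      go y with succ-view y
      ... | tz a _ = ⊥-elim (σt≢0 e y a)
      ... | tn j a a' = trans (sucδ y) (trans a' (sym a))

    insert-remove-cycle : ∀ z → s0 ≡ suc z →
        tabulate (bodyσ (λ y → does (lookup (removeFromPerm s0 σt) y ≟F z)) (removeFromPerm s0 σt)) ≡ σt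
    insert-remove-cycle z e = vec-ext (λ y → trans (lookup∘tabulate _ y) (go y))
      where
      t = λ y → does (lookup (removeFromPerm s0 σt) y ≟F z)
      go : ∀ y → bodyσ t (removeFromPerm s0 σt) y ≡ lookup σt y
      go y with succ-view y
      ... | tz a a' = trans (cong (λ b → if b then zero else suc (lookup (removeFromPerm s0 σt) y))
                       (trans (cong (λ u → does (u ≟F z)) (suc-injective (trans (sucδ y) (trans a' e)))) (dEq z)))
                           (sym a)
      ... | tn j a a' with t y in ty
      ...   | true = ⊥-elim (0≢1+n
          (s-inj v zero (suc y) (trans e (trans (cong suc (sym (dTrue _ _ ty))) (trans (sucδ y) (trans a' (sym a)))))))
      ...   | false = trans (sucδ y) (trans a' (sym a))

module ListSystems where

  open WordSurgery
  open WordFacts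
  open ColouredPermutations
  open Search

  record IsListSystem (n k : ℕ) (A : Subset n) (λs : List (List (Fin n))) : Set where
    constructor mkListSystem
    field
      l-cnt : length λs ≡ k
      l-ne : All (λ w → w ≢ []) λs
      l-uq : Unique (concat λs)
      l-cov : ∀ x → (x ∈ₗ concat λs) ⇔ (x ∉ A)
  open IsListSystem public

  concat-lowerSystem : ∀ {n} (L : List (List (Fin (suc n)))) → concat (lowerSystem L) ≡ lowerWord (concat L)
  concat-lowerSystem L = trans (concat-dropEmpty (map lowerWord L)) (concat-map-lower L)

  neIn : ∀ {n} {L : List (List (Fin (suc n)))} → All (λ w → w ≢ []) L → zero ∉ₗ concat L → ∀ {w} → w ∈ₗ L →
      lowerWord w ≢ []
  neIn a z m = lower-nonempty′ _ (All.lookup a m) (λ zm → z (∈-concat⁺′ zm m))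

  lowerSystem-map : ∀ {n} (L : List (List (Fin (suc n)))) → (∀ {w} → w ∈ₗ L → lowerWord w ≢ []) →
      lowerSystem L ≡ map lowerWord L
  lowerSystem-map L h = dropEmpty-id (map lowerWord L) (All.tabulate (λ {w'} m → go m))
    where
    go : ∀ {w'} → w' ∈ₗ map lowerWord L → w' ≢ []
    go m with ∈-map⁻ lowerWord m
    ... | w , mw , refl = h mw

  strict-around : ∀ {A : Set} (pre : List (List A)) W post → Unique (concat (pre ++ W ∷ post)) →
    ∀ {a} → a ∈ₗ W → a ∉ₗ concat pre × a ∉ₗ concat post
  strict-around pre W post uq m =
    uniq-++ʳ (concat pre) U (∈-++⁺ˡ m) , uniq-++ˡ W (uniq-++₂ (concat pre) U) m
    where
    U : Unique (concat pre ++ W ++ concat post)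
    U = subst Unique (concat-split pre W post) uq

  lowerSystem-around : ∀ {n} (pre : List (List (Fin (suc n)))) W post → All (λ w → w ≢ []) (pre ++ W ∷ post) →
    zero ∉ₗ concat pre → zero ∉ₗ concat post →
    lowerSystem (pre ++ W ∷ post) ≡ map lowerWord pre ++ dropEmpty (lowerWord W ∷ []) ++ map lowerWord post
  lowerSystem-around pre W post ne zpre zpost =
    trans (cong dropEmpty (map-++ lowerWord pre (W ∷ post)))
      (trans (dropEmpty-++ (map lowerWord pre) (lowerWord W ∷ map lowerWord post))
        (cong₂ _++_ (lowerSystem-map pre (neIn aPre zpre))
          (trans (dropEmpty-++ (lowerWord W ∷ []) (map lowerWord post))
            (cong (dropEmpty (lowerWord W ∷ []) ++_) (lowerSystem-map post (neIn aPost zpost))))))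
    where
    aPre : All (λ w → w ≢ []) pre
    aPre = All.tabulate (λ m → All.lookup ne (∈-++⁺ˡ m))
    aPost : All (λ w → w ≢ []) post
    aPost = All.tabulate (λ m → All.lookup ne (∈-++⁺ʳ pre (there m)))

  singleton-length : ∀ {n k} (pre post : List (List (Fin (suc n)))) → All (λ w → w ≢ []) (pre ++ (zero ∷ []) ∷ post) →
    Unique (concat (pre ++ (zero ∷ []) ∷ post)) → length (pre ++ (zero ∷ []) ∷ post) ≡ k →
    suc (length (lowerSystem (pre ++ (zero ∷ []) ∷ post))) ≡ k
  singleton-length pre post ne uq cn = begin
    suc (length (lowerSystem (pre ++ (zero ∷ []) ∷ post)))
      ≡⟨ cong (λ L → suc (length L)) (lowerSystem-around pre (zero ∷ []) post ne (proj₁ z∉) (proj₂ z∉)) ⟩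
    suc (length (map lowerWord pre ++ map lowerWord post))
      ≡⟨ cong suc (length-++ (map lowerWord pre)) ⟩
    suc (length (map lowerWord pre) + length (map lowerWord post))
      ≡⟨ cong₂ (λ a b → suc (a + b)) (length-map lowerWord pre) (length-map lowerWord post) ⟩
    suc (length pre + length post)
      ≡⟨ sym (+-suc (length pre) (length post)) ⟩
    length pre + length ((zero ∷ []) ∷ post)
      ≡⟨ sym (length-++ pre) ⟩
    length (pre ++ (zero ∷ []) ∷ post)
      ≡⟨ cn ⟩
    _ ∎
    where
    open ≡.≡-Reasoning
    z∉ = strict-around pre (zero ∷ []) post uq (here refl)

  module LowerSystemValid {n k} (a0 : Bool) (A' : Subset n) (λs : List (List (Fin (suc n))))
      (v : IsListSystem (suc n) k (a0 ∷ A') λs) where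

    lowered-unique : Unique (concat (lowerSystem λs))
    lowered-unique = subst Unique (sym (concat-lowerSystem λs)) (unique-lower _ (l-uq v))

    lowered-covers : ∀ x → (x ∈ₗ concat (lowerSystem λs)) ⇔ (x ∉ A')
    lowered-covers x = mk⇔ (λ m mA → Equivalence.to (l-cov v (suc x))
        (mem-lower⇒ _ (subst (x ∈ₗ_) (concat-lowerSystem λs) m)) (there mA))
                (λ h → subst (x ∈ₗ_) (sym (concat-lowerSystem λs))
                    (mem-lower⇐ _ (Equivalence.from (l-cov v (suc x)) (λ { (there m) → h m }))))

    lowerSystem-no-singleton : zero ∷ [] ∉ₗ λs → lowerSystem λs ≡ map lowerWord λs
    lowerSystem-no-singleton ns =
        lowerSystem-map λs (λ mw →
        lower-nonempty _ (All.lookup (l-ne v) mw) (uniq-concat-mem λs (l-uq v) mw) (λ { refl → ns mw }))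

    lowered-valid : zero ∷ [] ∉ₗ λs → IsListSystem n k A' (lowerSystem λs)
    lowered-valid ns = mkListSystem
        (trans (cong length (lowerSystem-no-singleton ns)) (trans (length-map lowerWord λs) (l-cnt v)))
        (dropEmpty-ne (map lowerWord λs)) lowered-unique lowered-covers

    lowered-valid′ : IsListSystem n (length (lowerSystem λs)) A' (lowerSystem λs)
    lowered-valid′ = mkListSystem refl (dropEmpty-ne (map lowerWord λs)) lowered-unique lowered-covers

  raised-valid : ∀ {n k} (a0 : Bool) (A' : Subset n) (λs' : List (List (Fin n))) → IsListSystem n k A' λs' →
    (t : Fin n → Bool) (b : Bool) → (∀ {x y} → t x ≡ true → t y ≡ true → x ≡ y) →
    ((∃ λ u → u ∈ₗ concat λs' × t u ≡ true) → a0 ≡ false) →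
    (a0 ≡ false → ∃ λ u → u ∈ₗ concat λs' × t u ≡ true) →
    IsListSystem (suc n) k (a0 ∷ A') (map (raiseWord t b) λs')
  raised-valid a0 A' λs' v t b tu h1 h2 = mkListSystem (trans (length-map (raiseWord t b) λs') (l-cnt v))
    (All.tabulate (λ m → ne m))
    (subst Unique (sym (concat-map-raise t b λs')) (unique-raise t b _ (l-uq v) (λ _ _ → tu)))
    cv
    where
    ne : ∀ {w} → w ∈ₗ map (raiseWord t b) λs' → w ≢ []
    ne m with ∈-map⁻ (raiseWord t b) m
    ... | w , mw , refl = raise-nonempty t b w (All.lookup (l-ne v) mw)
    C = concat λs'
    cv : ∀ x → (x ∈ₗ concat (map (raiseWord t b) λs')) ⇔ (x ∉ (a0 ∷ A'))
    cv zero = mk⇔ (λ m zA → false≢true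
        (trans (sym (h1 (mem-raise-zero⇒ t b C (subst (zero ∈ₗ_) (concat-map-raise t b λs') m)))) (∈⇒ zA)))
                  (λ h → subst (zero ∈ₗ_) (sym (concat-map-raise t b λs'))
                     (let (u , mu , tu') = h2 (∉⇒ h) in mem-raise-zero⇐ t b C mu tu'))
    cv (suc y) = mk⇔ (λ m → λ { (there yA) →
        Equivalence.to (l-cov v y) (mem-raise-suc⇒ t b C (subst (suc y ∈ₗ_) (concat-map-raise t b λs') m)) yA })
                     (λ h → subst (suc y ∈ₗ_) (sym (concat-map-raise t b λs'))
                         (mem-raise-suc⇐ t b C (Equivalence.from (l-cov v y) (λ m → h (there m)))))

  never : ∀ {n} → Fin n → Bool
  never _ = false

  singleton-valid : ∀ {n k'} (A' : Subset n) (λs' : List (List (Fin n))) → IsListSystem n k' A' λs' →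
    IsListSystem (suc n) (suc k') (false ∷ A') ((zero ∷ []) ∷ map (raiseWord never true) λs')
  singleton-valid A' λs' v = mkListSystem (cong suc (trans (length-map (raiseWord never true) λs') (l-cnt v)))
    ((λ ()) ∷ All.tabulate ne)
    (¬Any⇒All¬ _ z∉ ∷ subst Unique (sym (concat-map-raise never true λs'))
        (unique-raise never true _ (l-uq v) (λ _ _ ())))
    cv
    where
    ne : ∀ {w} → w ∈ₗ map (raiseWord never true) λs' → w ≢ []
    ne m with ∈-map⁻ (raiseWord never true) m
    ... | w , mw , refl = raise-nonempty never true w (All.lookup (l-ne v) mw)
    C = concat λs'
    z∉ : zero ∉ₗ concat (map (raiseWord never true) λs')
    z∉ m with mem-raise-zero⇒ never true C (subst (zero ∈ₗ_) (concat-map-raise never true λs') m)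
    ... | _ , _ , ()
    cv : ∀ x → (x ∈ₗ (zero ∷ concat (map (raiseWord never true) λs'))) ⇔ (x ∉ (false ∷ A'))
    cv zero = mk⇔ (λ _ zA → false≢true (∈⇒ zA)) (λ _ → here refl)
    cv (suc y) = mk⇔ (λ { (here ()) ; (there m) →
        λ { (there yA) → Equivalence.to (l-cov v y)
        (mem-raise-suc⇒ never true C (subst (suc y ∈ₗ_) (concat-map-raise never true λs') m)) yA } })
                     (λ h → there (subst (suc y ∈ₗ_) (sym (concat-map-raise never true λs'))
                         (mem-raise-suc⇐ never true C (Equivalence.from (l-cov v y) (λ m → h (there m))))))

  lower∘raise : ∀ {n} t b (λs' : List (List (Fin n))) → All (λ w → w ≢ []) λs' →
      lowerSystem (map (raiseWord t b) λs') ≡ λs'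
  lower∘raise t b λs' ne = trans (lowerSystem-map (map (raiseWord t b) λs') h) (trans (sym (map-∘ λs')) (go λs'))
    where
    h : ∀ {w} → w ∈ₗ map (raiseWord t b) λs' → lowerWord w ≢ []
    h m with ∈-map⁻ (raiseWord t b) m
    ... | w , mw , refl = subst (_≢ []) (sym (lower-raise t b w)) (All.lookup ne mw)
    go : ∀ L → map (λ w → lowerWord (raiseWord t b w)) L ≡ L
    go [] = refl
    go (w ∷ L) = cong₂ _∷_ (lower-raise t b w) (go L)

-- The heads of a list system, which index the k ways to put 0 in front of a
-- list; and the position of 0 in a word.
module Heads where

  open WordSurgery
  open WordFacts
  open ColouredPermutations
  open ListSystems
  open Search

  data Head {A : Set} (h : A) : List A → Set where
    is-head : ∀ {r} → Head h (h ∷ r)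

  head? : ∀ {n} (h : Fin n) w → Dec (Head h w)
  head? h [] = no (λ ())
  head? h (x ∷ r) with h ≟F x
  ... | yes refl = yes is-head
  ... | no ne = no (λ { is-head → ne refl })

  heads : ∀ {n} → List (List (Fin n)) → Vec Bool n
  heads L = tabulate (λ h → does (any? (head? h) L))

  headList : ∀ {A : Set} → List (List A) → List A
  headList [] = []
  headList ([] ∷ L) = headList L
  headList ((x ∷ w) ∷ L) = x ∷ headList L

  headList-mem⇒ : ∀ {A : Set} (L : List (List A)) {h} → Any (Head h) L → h ∈ₗ headList L
  headList-mem⇒ ((x ∷ w) ∷ L) (here is-head) = here refl
  headList-mem⇒ ([] ∷ L) (there a) = headList-mem⇒ L a
  headList-mem⇒ ((x ∷ w) ∷ L) (there a) = there (headList-mem⇒ L a)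

  headList-mem⇐ : ∀ {A : Set} (L : List (List A)) {h} → h ∈ₗ headList L → Any (Head h) L
  headList-mem⇐ ([] ∷ L) m = there (headList-mem⇐ L m)
  headList-mem⇐ ((x ∷ w) ∷ L) (here refl) = here is-head
  headList-mem⇐ ((x ∷ w) ∷ L) (there m) = there (headList-mem⇐ L m)

  headList-⊆ : ∀ {A : Set} (L : List (List A)) {h} → h ∈ₗ headList L → h ∈ₗ concat L
  headList-⊆ ([] ∷ L) m = headList-⊆ L m
  headList-⊆ ((x ∷ w) ∷ L) (here refl) = here refl
  headList-⊆ ((x ∷ w) ∷ L) (there m) = there (∈-++⁺ʳ w (headList-⊆ L m))

  headList-unique : ∀ {A : Set} (L : List (List A)) → Unique (concat L) → Unique (headList L)
  headList-unique [] u = []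
  headList-unique ([] ∷ L) u = headList-unique L u
  headList-unique ((x ∷ w) ∷ L) (p ∷ u) =
      ¬Any⇒All¬ _ (λ m → All¬⇒¬Any p (∈-++⁺ʳ w (headList-⊆ L m))) ∷ headList-unique L (uniq-++₂ w u)

  headList-length : ∀ {A : Set} (L : List (List A)) → All (λ w → w ≢ []) L → length (headList L) ≡ length L
  headList-length [] a = refl
  headList-length ([] ∷ L) (p ∷ a) = ⊥-elim (p refl)
  headList-length ((x ∷ w) ∷ L) (p ∷ a) = cong suc (headList-length L a)

  decP : ∀ {P : Set} (d : Dec P) → does d ≡ true → P
  decP (yes p) e = p
  decP (no _) ()

  decEq : ∀ {P Q : Set} (d : Dec P) (d' : Dec Q) → (P → Q) → (Q → P) → does d ≡ does d'
  decEq (yes p) (yes q) f g = refl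
  decEq (yes p) (no nq) f g = ⊥-elim (nq (f p))
  decEq (no np) (yes q) f g = ⊥-elim (np (g q))
  decEq (no np) (no nq) f g = refl

  count-none : ∀ {n} (S : Vec Bool n) → (∀ h → lookup S h ≢ true) → count S ≡ 0
  count-none [] h = refl
  count-none (true ∷ S) h = ⊥-elim (h zero refl)
  count-none (false ∷ S) h = count-none S (λ i → h (suc i))

  count-list : ∀ {n} (L : List (Fin n)) (S : Vec Bool n) → Unique L → (∀ h → lookup S h ≡ true → h ∈ₗ L) →
      (∀ h → h ∈ₗ L → lookup S h ≡ true) → count S ≡ length L
  count-list [] S u f g = count-none S (λ h e → case (f h e))
    where case : ∀ {h} → h ∈ₗ [] → ⊥
          case ()
  count-list (x ∷ L) S (p ∷ u) f g =
      trans (count-remove S T x (g x (here refl)) (lookup∘update x S false)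
      (λ i i≢x → sym (lookup∘update′ i≢x S false)))
     (cong suc (count-list L T u f' g'))
    where
    T = S [ x ]≔ false
    f' : ∀ h → lookup T h ≡ true → h ∈ₗ L
    f' h e with h ≟F x
    ... | yes refl = ⊥-elim (false≢true (trans (sym (lookup∘update x S false)) e))
    ... | no ne with f h (trans (sym (lookup∘update′ ne S false)) e)
    ... | here eq = ⊥-elim (ne eq)
    ... | there m = m
    g' : ∀ h → h ∈ₗ L → lookup T h ≡ true
    g' h m with h ≟F x
    ... | yes refl = ⊥-elim (All¬⇒¬Any p m)
    ... | no ne = trans (lookup∘update′ ne S false) (g h (there m))

  heads-lookup : ∀ {n} (L : List (List (Fin n))) h → lookup (heads L) h ≡ does (any? (head? h) L)
  heads-lookup L h = lookup∘tabulate _ h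

  count-heads : ∀ {n k} {A : Subset n} (λs : List (List (Fin n))) → IsListSystem n k A λs → count (heads λs) ≡ k
  count-heads λs v = trans (count-list (headList λs) (heads λs) (headList-unique λs (l-uq v))
     (λ h e → headList-mem⇒ λs (decP (any? (head? h) λs) (trans (sym (heads-lookup λs h)) e)))
     (λ h m → trans (heads-lookup λs h) (dec-true (any? (head? h) λs) (headList-mem⇐ λs m))))
     (trans (headList-length λs (l-ne v)) (l-cnt v))

  adj-uniq-neq : ∀ {A : Set} {a b : A} {w} → Unique w → Adj a b w → a ≢ b
  adj-uniq-neq ((p ∷ _) ∷ u) ah e = p e
  adj-uniq-neq (_ ∷ u) (at q) e = adj-uniq-neq u q e

  data ZP {n} (w : List (Fin (suc n))) : Set where
    zpAdj : ∀ y → Adj (suc y) zero w → ZP w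
    zpSing : w ≡ zero ∷ [] → ZP w
    zpHead : ∀ h r → w ≡ zero ∷ suc h ∷ r → ZP w

  zeroPos : ∀ {n} (w : List (Fin (suc n))) → Unique w → zero ∈ₗ w → ZP w
  zeroPos w u m with ∈-∃++ m
  ... | pre , v , refl with last-view pre
  zeroPos .([] ++ [ zero ] ++ v) u m | .[] , v , refl | inj₁ refl with v
  ... | [] = zpSing refl
  ... | zero ∷ r = ⊥-elim (adj-uniq-neq u ah refl)
  ... | suc h ∷ r = zpHead h r refl
  zeroPos .(pre ++ [ zero ] ++ v) u m | pre , v ,
      refl | inj₂ (u' , a , refl) with subst (Adj a zero) (sym (++-assoc u' (a ∷ []) (zero ∷ v))) (adj-++ u')
  ... | q with a
  ... | zero = ⊥-elim (adj-uniq-neq u q refl)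
  ... | suc y = zpAdj y q

module ReinsertionLaws where

  open WordSurgery
  open WordFacts
  open ColouredPermutations
  open ListSystems
  open Heads

  ++∷≢[] : ∀ {A : Set} (xs : List A) {y zs} → xs ++ y ∷ zs ≢ []
  ++∷≢[] [] ()
  ++∷≢[] (x ∷ xs) ()

  map-raise-lower : ∀ {n} t b (L : List (List (Fin (suc n)))) → (∀ {w} → w ∈ₗ L → zero ∉ₗ w) →
    (∀ {w x} → w ∈ₗ L → suc x ∈ₗ w → t x ≡ false) → map (raiseWord t b) (map lowerWord L) ≡ L
  map-raise-lower t b [] h1 h2 = refl
  map-raise-lower t b (w ∷ L) h1 h2 = cong₂ _∷_ (raise-lower t b w (h1 (here refl)) (λ x m → h2 (here refl) m))
                                       (map-raise-lower t b L (λ m → h1 (there m)) (λ m → h2 (there m)))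

  trueLaw : ∀ {n} (λs : List (List (Fin (suc n)))) → All (λ w → w ≢ []) λs → zero ∉ₗ concat λs →
    map (raiseWord never true) (lowerSystem λs) ≡ λs
  trueLaw λs ne z = trans (cong (map (raiseWord never true)) (lowerSystem-map λs (neIn ne z)))
    (map-raise-lower never true λs (λ mw zw → z (∈-concat⁺′ zw mw)) (λ _ _ → refl))

  singLaw : ∀ {n} (pre post : List (List (Fin (suc n)))) → All (λ w → w ≢ []) (pre ++ (zero ∷ []) ∷ post) →
    Unique (concat (pre ++ (zero ∷ []) ∷ post)) →
    ((zero ∷ []) ∷ map (raiseWord never true) (lowerSystem (pre ++ (zero ∷ []) ∷ post))) ↭ (pre ++ (zero ∷ []) ∷ post)
  singLaw pre post ne uq = ↭-trans (↭-prep (zero ∷ []) (↭-reflexive eq)) (↭-sym (shift (zero ∷ []) pre post))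
    where
    zpre = proj₁ (strict-around pre (zero ∷ []) post uq (here refl))
    zpost = proj₂ (strict-around pre (zero ∷ []) post uq (here refl))
    eq : map (raiseWord never true) (lowerSystem (pre ++ (zero ∷ []) ∷ post)) ≡ pre ++ post
    eq = trans (cong (map (raiseWord never true)) (lowerSystem-around pre (zero ∷ []) post ne zpre zpost))
        (trans (map-++ (raiseWord never true) (map lowerWord pre) (map lowerWord post))
         (cong₂ _++_ (map-raise-lower never true pre (λ mw zw → zpre (∈-concat⁺′ zw mw)) (λ _ _ → refl))
                     (map-raise-lower never true post (λ mw zw → zpost (∈-concat⁺′ zw mw)) (λ _ _ → refl))))

  -- and 0 inside a word W = u ++ p ++ v, next to the unique selected letter y
  -- (p is [y+1, 0] or [0, y+1]).
  midLaw : ∀ {n} (t : Fin n → Bool) b y (p : List (Fin (suc n))) (pre : List (List (Fin (suc n)))) u v post →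
    lowerWord p ≡ y ∷ [] → raiseWord t b (y ∷ []) ≡ p → (∀ x → t x ≡ true → x ≡ y) → zero ∈ₗ p → suc y ∈ₗ p →
    All (λ w → w ≢ []) (pre ++ (u ++ p ++ v) ∷ post) → Unique (concat (pre ++ (u ++ p ++ v) ∷ post)) →
    map (raiseWord t b) (lowerSystem (pre ++ (u ++ p ++ v) ∷ post)) ≡ pre ++ (u ++ p ++ v) ∷ post
  midLaw t b y p pre u v post dlp insp ty zp yp ne uq =
    trans (cong (map (raiseWord t b)) eqd)
        (trans (map-++ (raiseWord t b) (map lowerWord pre) (lowerWord W ∷ map lowerWord post))
     (cong₂ _++_ (map-raise-lower t b pre (λ mw zw → out₁ zp (∈-concat⁺′ zw mw))
         (λ mw m → tf (λ e → out₁ yp (∈-concat⁺′ (subst (λ q → suc q ∈ₗ _) e m) mw))))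
       (cong₂ _∷_ insW (map-raise-lower t b post (λ mw zw → out₄ zp (∈-concat⁺′ zw mw))
           (λ mw m → tf (λ e → out₄ yp (∈-concat⁺′ (subst (λ q → suc q ∈ₗ _) e m) mw)))))))
    where
    W = u ++ p ++ v
    inW : ∀ {a} → a ∈ₗ p → a ∈ₗ W
    inW m = ∈-++⁺ʳ u (∈-++⁺ˡ m)
    out₁ : ∀ {a} → a ∈ₗ p → a ∉ₗ concat pre
    out₁ m = proj₁ (strict-around pre W post uq (inW m))
    out₄ : ∀ {a} → a ∈ₗ p → a ∉ₗ concat post
    out₄ m = proj₂ (strict-around pre W post uq (inW m))
    UW : Unique W
    UW = uniq-concat-mem (pre ++ W ∷ post) uq (∈-++⁺ʳ pre (here refl))
    out₂ : ∀ {a} → a ∈ₗ p → a ∉ₗ u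
    out₂ m = uniq-++ʳ u UW (∈-++⁺ˡ m)
    out₃ : ∀ {a} → a ∈ₗ p → a ∉ₗ v
    out₃ m = uniq-++ˡ p (uniq-++₂ u UW) m
    tf : ∀ {x} → x ≢ y → t x ≡ false
    tf {x} ne' with t x in e
    ... | true = ⊥-elim (ne' (ty x e))
    ... | false = refl
    dlW : lowerWord W ≡ lowerWord u ++ y ∷ lowerWord v
    dlW = trans (lower-++ u (p ++ v)) (cong (lowerWord u ++_) (trans (lower-++ p v) (cong (_++ lowerWord v) dlp)))
    eqd : lowerSystem (pre ++ W ∷ post) ≡ map lowerWord pre ++ lowerWord W ∷ map lowerWord post
    eqd = trans (lowerSystem-around pre W post ne (out₁ zp) (out₄ zp))
      (cong (λ L → map lowerWord pre ++ L ++ map lowerWord post)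
        (dropEmpty-id (lowerWord W ∷ []) ((λ e → ++∷≢[] (lowerWord u) (trans (sym dlW) e)) ∷ [])))
    insW : raiseWord t b (lowerWord W) ≡ W
    insW = trans (cong (raiseWord t b) dlW) (trans (raise-++ t b (lowerWord u) (y ∷ lowerWord v))
           (cong₂ _++_ (raise-lower t b u (out₂ zp) (λ x m → tf (λ e → out₂ yp (subst (λ q → suc q ∈ₗ u) e m))))
             (trans (raise-++ t b (y ∷ []) (lowerWord v))
                 (cong₂ _++_ insp (raise-lower t b v (out₃ zp)
                 (λ x m → tf (λ e → out₃ yp (subst (λ q → suc q ∈ₗ v) e m))))))))

module ZeroMarkers where

  open WordSurgery
  open WordFacts
  open ColouredPermutations
  open ListSystems
  open Heads
  open Search

  -- The three ways 0 can occur in the lists, as decidable markers: the word [0]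
  -- is present, 0 follows y, or 0 starts a word and is followed by h.
  singletonZero? : ∀ {n} (λs : List (List (Fin (suc n)))) → Dec ((zero ∷ []) ∈ₗ λs)
  singletonZero? λs = any? (λ w → ≡-decL _≟F_ (zero ∷ []) w) λs

  hasSingletonZero : ∀ {n} → List (List (Fin (suc n))) → Bool
  hasSingletonZero λs = does (singletonZero? λs)

  zeroAfter : ∀ {n} → List (List (Fin (suc n))) → Fin n → Bool
  zeroAfter λs y = does (any? (adj? (suc y) zero) λs)

  zeroBefore : ∀ {n} → List (List (Fin (suc n))) → Fin n → Bool
  zeroBefore λs h = does (any? (adj? zero (suc h)) λs)

  hasSingletonZero-↭ : ∀ {n} {L L' : List (List (Fin (suc n)))} → L ↭ L' → hasSingletonZero L ≡ hasSingletonZero L'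
  hasSingletonZero-↭ p = decEq (singletonZero? _) (singletonZero? _) (Any-resp-↭ p) (Any-resp-↭ (↭-sym p))

  zeroAfter-↭ : ∀ {n} {L L' : List (List (Fin (suc n)))} → L ↭ L' → ∀ y → zeroAfter L y ≡ zeroAfter L' y
  zeroAfter-↭ p y = decEq (any? (adj? (suc y) zero) _) (any? (adj? (suc y) zero) _) (Any-resp-↭ p)
      (Any-resp-↭ (↭-sym p))

  zeroBefore-↭ : ∀ {n} {L L' : List (List (Fin (suc n)))} → L ↭ L' → ∀ h → zeroBefore L h ≡ zeroBefore L' h
  zeroBefore-↭ p h = decEq (any? (adj? zero (suc h)) _) (any? (adj? zero (suc h)) _) (Any-resp-↭ p)
      (Any-resp-↭ (↭-sym p))

  heads-↭ : ∀ {n} {L L' : List (List (Fin n))} → L ↭ L' → heads L ≡ heads L'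
  heads-↭ p = vec-ext (λ h →
      trans (lookup∘tabulate _ h)
      (trans (decEq (any? (head? h) _) (any? (head? h) _) (Any-resp-↭ p) (Any-resp-↭ (↭-sym p)))
      (sym (lookup∘tabulate _ h))))

  lowerSystem-↭ : ∀ {n} {L L' : List (List (Fin (suc n)))} → L ↭ L' → lowerSystem L ↭ lowerSystem L'
  lowerSystem-↭ p = dropEmpty-↭ (map⁺ lowerWord p)

  hasSingletonZero-prev : ∀ {n} (L : List (List (Fin (suc n)))) → hasSingletonZero ((zero ∷ []) ∷ L) ≡ true
  hasSingletonZero-prev L = dec-true (singletonZero? ((zero ∷ []) ∷ L)) (here refl)

  hasSingletonZero-raise : ∀ {n} t b (λs' : List (List (Fin n))) → All (λ w → w ≢ []) λs' →
      hasSingletonZero (map (raiseWord t b) λs') ≡ false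
  hasSingletonZero-raise t b λs' ne = dec-false (singletonZero? _) (λ m → case (∈-map⁻ (raiseWord t b) m))
    where
    case : ∃ (λ w → w ∈ₗ λs' × zero ∷ [] ≡ raiseWord t b w) → ⊥
    case (w , mw , e) = raise-not-singleton t b w (All.lookup ne mw) (sym e)

  zeroAfter-raise : ∀ {n} z (λs' : List (List (Fin n))) → z ∈ₗ concat λs' →
    first (zeroAfter (map (raiseWord (λ v → does (v ≟F z)) false) λs')) ≡ just z
  zeroAfter-raise z λs' mz =
      first-uniq _ z (dec-true (any? _ _)
      (anyMapP (proj₁ (proj₂ c)) (adj-raise-after t (proj₁ c) (dEq z) (proj₂ (proj₂ c)))))
    (λ y e → uq (decP (any? _ _) e))
    where
    t = λ v → does (v ≟F z)
    c : ∃ λ w → w ∈ₗ λs' × z ∈ₗ w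
    c with ∈-concat⁻′ λs' mz
    ... | w , zw , mw = w , mw , zw
    anyMapP : ∀ {P : List (Fin (suc _)) → Set} {w} → w ∈ₗ λs' → P (raiseWord t false w) →
        Any P (map (raiseWord t false) λs')
    anyMapP m p = Any.map⁺ (lose m p)
    uq : ∀ {y} → Any (Adj (suc y) zero) (map (raiseWord t false) λs') → y ≡ z
    uq a with find (Any.map⁻ a)
    ... | w , mw , q = dTrue _ _ (adj-raise-after⁻ t w q)

  noAdjHead : ∀ {A : Set} {y h : A} {r} → Unique (h ∷ r) → Adj y h (h ∷ r) → ⊥
  noAdjHead (p ∷ u) ah = All¬⇒¬Any p (here refl)
  noAdjHead (p ∷ u) (at q) = All¬⇒¬Any p (adj-mem₂ q)

  module FrontInsertion {n k} {A' : Subset n} (λs' : List (List (Fin n))) (v : IsListSystem n k A' λs') (h : Fin n)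
      (hh : Any (Head h) λs') where
    t = λ x → does (x ≟F h)

    w0 : List (Fin n)
    w0 = proj₁ (find hh)
    mw0 : w0 ∈ₗ λs'
    mw0 = proj₁ (proj₂ (find hh))
    hw0 : Head h w0
    hw0 = proj₂ (proj₂ (find hh))

    hdMem : ∀ {x : Fin n} {w} → Head x w → x ∈ₗ w
    hdMem is-head = here refl

    zeroAfter-none : ∀ y → zeroAfter (map (raiseWord t true) λs') y ≡ false
    zeroAfter-none y = dec-false (any? _ _) (λ a → go a)
      where
      go : Any (Adj (suc y) zero) (map (raiseWord t true) λs') → ⊥
      go a with find (Any.map⁻ a)
      ... | w , mw , q with adj-raise-pred⁻ t w q
      ... | x , tx , q' with dTrue x h tx
      ... | refl = hdCase w0 hw0 (uniq-concat-mem λs' (l-uq v) mw0)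
          (subst (Adj y h) (uniq-concat-same λs' (l-uq v) (adj-mem₂ q') mw (hdMem hw0) mw0) q')
        where
        hdCase : ∀ w → Head h w → Unique w → Adj y h w → ⊥
        hdCase .(h ∷ _) is-head u q'' = noAdjHead u q''

    zeroAfter-first : first (zeroAfter (map (raiseWord t true) λs')) ≡ nothing
    zeroAfter-first = first-none _ zeroAfter-none

    zeroBefore-first : first (zeroBefore (map (raiseWord t true) λs')) ≡ just h
    zeroBefore-first = first-uniq _ h (dec-true (any? _ _) (Any.map⁺ (lose mw0 (hdAdj hw0))))
      (λ h' e → uq (decP (any? _ _) e))
      where
      hdAdj : ∀ {w} → Head h w → Adj zero (suc h) (raiseWord t true w)
      hdAdj {.h ∷ r} is-head = adj-raise-before t (h ∷ r) (dEq h) (here refl)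
      uq : ∀ {h'} → Any (Adj zero (suc h')) (map (raiseWord t true) λs') → h' ≡ h
      uq a with find (Any.map⁻ a)
      ... | w , mw , q = dTrue _ _ (adj-raise-before⁻ t w q)

module LCDecomposition where

  open Recurrence
  open WordSurgery
  open WordFacts
  open ColouredPermutations
  open ListSystems
  open Heads
  open ReinsertionLaws
  open ZeroMarkers
  open Search

  LCC : ℕ → ℕ → ℕ → Set
  LCC n k c = Σ (LCRaw n c) (IsLC n k c)

  LC : ℕ → ℕ → ℕ → Setoid₀
  LC n k c = On.setoid {B = LCC n k c} (LCRawSetoid n c) proj₁

  module _ {n k c : ℕ} {A : Subset n} {σ : Vec (Fin n) n} {col : Vec (Maybe (Fin c)) n} {λs : List (List (Fin n))} where
    perm-part : IsLC n k c ((A , σ , col) , λs) → IsColouredPerm n c A σ col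
    perm-part v = mkColouredPerm (IsLC.σ-injective v) (IsLC.σ-fixes-offA v) (IsLC.col-onA v) (IsLC.col-offA v)
        (IsLC.col-cycle v)

    lists-part : IsLC n k c ((A , σ , col) , λs) → IsListSystem n k A λs
    lists-part v = mkListSystem (IsLC.λ-count v) (IsLC.λ-nonempty v) (IsLC.λ-strict-disjoint v) (IsLC.λ-covers-B v)

    mkIsLC : IsColouredPerm n c A σ col → IsListSystem n k A λs → IsLC n k c ((A , σ , col) , λs)
    mkIsLC cp ll = isLC (s-inj cp) (s-fix cp) (c-on cp) (c-off cp) (c-cyc cp) (l-cnt ll) (l-ne ll) (l-uq ll) (l-cov ll)

  singleton-length′ : ∀ {n k} {A : Subset (suc n)} (λs : List (List (Fin (suc n)))) →
      IsListSystem (suc n) k A λs → (zero ∷ []) ∈ₗ λs →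
    suc (length (lowerSystem λs)) ≡ k
  singleton-length′ λs v m with ∈-∃++ m
  ... | pre , post , refl = singleton-length pre post (l-ne v) (l-uq v) (l-cnt v)

  zeroIn : ∀ {n k} {A' : Subset n} (λs : List (List (Fin (suc n)))) → IsListSystem (suc n) k (false ∷ A') λs →
      zero ∈ₗ concat λs
  zeroIn λs v = Equivalence.from (l-cov v zero) (λ m → false≢true (∈⇒ m))

  noneCase : ∀ {n k} {A' : Subset n} (λs : List (List (Fin (suc n)))) → IsListSystem (suc n) k (false ∷ A') λs →
    hasSingletonZero λs ≡ false → first (zeroAfter λs) ≡ nothing → first (zeroBefore λs) ≡ nothing → ⊥
  noneCase λs v e1 e2 e3 with ∈-concat⁻′ λs (zeroIn λs v)
  ... | w0 , zw , mw with zeroPos w0 (uniq-concat-mem λs (l-uq v) mw) zw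
  ... | zpAdj y q = false≢true
      (trans (sym (first-nothing (zeroAfter λs) e2 y)) (dec-true (any? (adj? (suc y) zero) λs) (lose mw q)))
  ... | zpSing refl = false≢true (trans (sym e1) (dec-true (singletonZero? λs) mw))
  ... | zpHead h r refl = false≢true
      (trans (sym (first-nothing (zeroBefore λs) e3 h)) (dec-true (any? (adj? zero (suc h)) λs) (lose mw ah)))

  headFacts : ∀ {n k} {A' : Subset n} (λs : List (List (Fin (suc n)))) → IsListSystem (suc n) k (false ∷ A') λs →
    first (zeroAfter λs) ≡ nothing → ∀ {h} → first (zeroBefore λs) ≡ just h → ∃₂ λ pre post → ∃ λ r →
        λs ≡ pre ++ (zero ∷ suc h ∷ r) ∷ post
  headFacts λs v e2 {h} e3 with any-split (decP (any? (adj? zero (suc h)) λs) (first-just (zeroBefore λs) e3))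
  ... | pre , post , w0 , eq ,
      q with zeroPos w0 (uniq-concat-mem λs (l-uq v) (subst (w0 ∈ₗ_) (sym eq) (∈-++⁺ʳ pre (here refl)))) (adj-mem₁ q)
  ... | zpAdj y q' = ⊥-elim (false≢true
      (trans (sym (first-nothing (zeroAfter λs) e2 y))
      (dec-true (any? (adj? (suc y) zero) λs) (subst (Any (Adj (suc y) zero)) (sym eq) (Any.++⁺ʳ pre (here q'))))))
  ... | zpSing refl = ⊥-elim (case q)
    where case : ∀ {n} {h : Fin n} → Adj zero (suc h) (zero ∷ []) → ⊥
          case (at ())
  ... | zpHead h' r refl = pre , post , r ,
      trans eq (cong (λ x → pre ++ (zero ∷ suc x ∷ r) ∷ post)
      (sym (hh q (uniq-concat-mem λs (l-uq v) (subst ((zero ∷ suc h' ∷ r) ∈ₗ_) (sym eq) (∈-++⁺ʳ pre (here refl)))))))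
    where
    hh : Adj zero (suc h) (zero ∷ suc h' ∷ r) → Unique (zero ∷ suc h' ∷ r) → h ≡ h'
    hh ah u = refl
    hh (at q'') (p ∷ u) = ⊥-elim (All¬⇒¬Any p (adj-mem₁ q''))

  afterFacts : ∀ {n} (λs : List (List (Fin (suc n)))) → ∀ {y} → first (zeroAfter λs) ≡ just y →
    ∃₂ λ pre post → ∃₂ λ u v → λs ≡ pre ++ (u ++ suc y ∷ zero ∷ v) ∷ post
  afterFacts λs {y} e with any-split (decP (any? (adj? (suc y) zero) λs) (first-just (zeroAfter λs) e))
  ... | pre , post , w0 , refl , q with adj-split q
  ... | u , v , refl = pre , post , u , v , refl

  dropEmpty-mem : ∀ {A : Set} (L : List (List A)) {w} → w ∈ₗ L → w ≢ [] → w ∈ₗ dropEmpty L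
  dropEmpty-mem ([] ∷ L) (here refl) ne = ⊥-elim (ne refl)
  dropEmpty-mem ((x ∷ w) ∷ L) (here refl) ne = here refl
  dropEmpty-mem ([] ∷ L) (there m) ne = dropEmpty-mem L m ne
  dropEmpty-mem ((x ∷ w) ∷ L) (there m) ne = there (dropEmpty-mem L m ne)

  headPr : ∀ {n k} {A' : Subset n} (λs : List (List (Fin (suc n)))) → IsListSystem (suc n) k (false ∷ A') λs →
    first (zeroAfter λs) ≡ nothing → ∀ {h} → first (zeroBefore λs) ≡ just h → lookup (heads (lowerSystem λs)) h ≡ true
  headPr λs v e2 {h} e3 with headFacts λs v e2 e3
  ... | pre , post , r , eq =
      trans (heads-lookup (lowerSystem λs) h) (dec-true (any? (head? h) (lowerSystem λs)) (lose m is-head))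
    where
    m : (h ∷ lowerWord r) ∈ₗ lowerSystem λs
    m = dropEmpty-mem (map lowerWord λs)
        (subst (λ L → (h ∷ lowerWord r) ∈ₗ map lowerWord L) (sym eq) (∈-map⁺ lowerWord (∈-++⁺ʳ pre (here refl)))) (λ ())

-- The bijection LC(n+1, k) ≅ LC(n, k-1) ⊎ LC(n, k) × (Fin c ⊎ Fin n ⊎ Fin k)
-- given by removing the point 0.
module LCStepMaps where

  open Recurrence
  open WordSurgery
  open WordFacts
  open ColouredPermutations
  open ListSystems
  open Heads
  open ReinsertionLaws
  open ZeroMarkers
  open LCDecomposition
  open Search

  LCChoice : ℕ → ℕ → ℕ → Set
  LCChoice c n k = Fin c ⊎ (Fin n ⊎ Fin k)

  LCStep : ℕ → ℕ → ℕ → Setoid₀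
  LCStep n k c = Prev (λ k' → LC n k' c) k ⊎ₛ (LC n k c ×ₛ ≡.setoid (LCChoice c n k))

  mkPrevLC : ∀ {n c k'} kk → kk ≡ suc k' → LCC n k' c → Carrier (Prev (λ k' → LC n k' c) kk)
  mkPrevLC .(suc _) refl x = x

  headIn : ∀ {n k} {A' : Subset n} (λs' : List (List (Fin n))) → (ll : IsListSystem n k A' λs') → ∀ j →
    unrank (heads λs') (cast (sym (count-heads λs' ll)) j) ∈ₗ concat λs'
  headIn λs' ll j with find (decP (any? (head? h) λs')
      (trans (sym (heads-lookup λs' h)) (unrank∈ (heads λs') (cast (sym (count-heads λs' ll)) j))))
    where h = unrank (heads λs') (cast (sym (count-heads λs' ll)) j)
  ... | w , mw , is-head = ∈-concat⁺′ (here refl) mw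

  module _ {n k c : ℕ} where

    -- Deleting 0 when 0 ∈ A keeps a valid element (0 is never a singleton word).
    remove-valid : ∀ A' s0 σt c0 colt λs → IsLC (suc n) k c (((true ∷ A') , (s0 ∷ σt) , (c0 ∷ colt)) , λs) →
         IsLC n k c ((A' , removeFromPerm s0 σt , colt) , lowerSystem λs)
    remove-valid A' s0 σt c0 colt λs v =
        mkIsLC (Removal.removed-valid true A' s0 σt c0 colt (perm-part v))
        (LowerSystemValid.lowered-valid true A' λs (lists-part v) ns)
      where
      ns : (zero ∷ []) ∉ₗ λs
      ns m = Equivalence.to (l-cov (lists-part v) zero) (∈-concat⁺′ (here refl) m) here

    -- Decomposition when 0 ∉ A, by the markers: singleton word [0] (one fewer
    -- list), 0 after y (choice y), 0 at the front before h (choice: rank of h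
    -- among the heads).
    split-offA : ∀ A' s0 σt c0 colt λs → IsLC (suc n) k c (((false ∷ A') , (s0 ∷ σt) , (c0 ∷ colt)) , λs) →
          (b : Bool) → hasSingletonZero λs ≡ b → (u : Maybe (Fin n)) → first (zeroAfter λs) ≡ u →
              (w : Maybe (Fin n)) → first (zeroBefore λs) ≡ w →
          Carrier (LCStep n k c)
    split-offA A' s0 σt c0 colt λs v true eb u eu w ew =
      inj₁ (mkPrevLC k (sym (singleton-length′ λs (lists-part v) (decP (singletonZero? λs) eb)))
             (((A' , removeFromPerm s0 σt , colt) , lowerSystem λs) ,
                 mkIsLC (Removal.removed-valid false A' s0 σt c0 colt (perm-part v))
                 (LowerSystemValid.lowered-valid′ false A' λs (lists-part v))))
    split-offA A' s0 σt c0 colt λs v false eb (just y) eu w ew =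
      inj₂ ((((A' , removeFromPerm s0 σt , colt) , lowerSystem λs) ,
          mkIsLC (Removal.removed-valid false A' s0 σt c0 colt (perm-part v))
          (LowerSystemValid.lowered-valid false A' λs (lists-part v) ns)) , inj₂ (inj₁ y))
      where ns : (zero ∷ []) ∉ₗ λs
            ns m = false≢true (trans (sym eb) (dec-true (singletonZero? λs) m))
    split-offA A' s0 σt c0 colt λs v false eb nothing eu (just h) ew =
      inj₂ ((((A' , removeFromPerm s0 σt , colt) , lowerSystem λs) ,
          mkIsLC (Removal.removed-valid false A' s0 σt c0 colt (perm-part v)) ll') ,
            inj₂ (inj₂ (cast (count-heads (lowerSystem λs) ll')
                (rank (heads (lowerSystem λs)) h (headPr λs (lists-part v) eu ew)))))
      where ns : (zero ∷ []) ∉ₗ λs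
            ns m = false≢true (trans (sym eb) (dec-true (singletonZero? λs) m))
            ll' = LowerSystemValid.lowered-valid false A' λs (lists-part v) ns
    split-offA A' s0 σt c0 colt λs v false eb nothing eu nothing ew = ⊥-elim (noneCase λs (lists-part v) eb eu ew)

    -- Decomposition of an element of LC on n + 1 points: 0 a fixed point of colour i,
    -- 0 in a cycle before z (choice z), or 0 ∉ A as in split-offA.
    lc-split : LCC (suc n) k c → Carrier (LCStep n k c)
    lc-split ((((true ∷ A') , (zero ∷ σt) , (just i ∷ colt)) , λs) , v) =
      inj₂ ((((A' , removeFromPerm zero σt , colt) , lowerSystem λs) , remove-valid A' zero σt (just i) colt λs v)
          , inj₁ i)
    lc-split ((((true ∷ A') , (zero ∷ σt) , (nothing ∷ colt)) , λs) , v) with c-on (perm-part v) zero here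
    ... | i , ()
    lc-split ((((true ∷ A') , (suc z ∷ σt) , (c0 ∷ colt)) , λs) , v) =
      inj₂ ((((A' , removeFromPerm (suc z) σt , colt) , lowerSystem λs) , remove-valid A' (suc z) σt c0 colt λs v)
          , inj₂ (inj₁ z))
    lc-split ((((false ∷ A') , (s0 ∷ σt) , (c0 ∷ colt)) , λs) , v) =
      split-offA A' s0 σt c0 colt λs v (hasSingletonZero λs) refl (first (zeroAfter λs)) refl
          (first (zeroBefore λs)) refl

    join-prev : ∀ kk → Carrier (Prev (λ k' → LC n k' c) kk) → LCC (suc n) kk c
    join-prev zero ()
    join-prev (suc k') (((A' , σ' , col') , λs') , v') =
      ((false ∷ A' , insertIntoPerm zero never σ' , nothing ∷ col') , (zero ∷ []) ∷ map (raiseWord never true) λs') ,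
      mkIsLC (Insertion.fixed-valid A' σ' col' (perm-part v') false nothing (λ ()) (λ _ → refl))
          (singleton-valid A' λs' (lists-part v'))

    -- Inverse of "choice z ∈ Fin n": insert 0 into the cycle before z if z ∈ A,
    -- and into the list right after z otherwise.
    join-at : ∀ A' σ' col' λs' → IsLC n k c ((A' , σ' , col') , λs') → (z : Fin n) → (b : Bool) →
        lookup A' z ≡ b → LCC (suc n) k c
    join-at A' σ' col' λs' v' z true e =
      ((true ∷ A' , insertIntoPerm (suc z) (λ y → does (lookup σ' y ≟F z)) σ' , lookup col' z ∷ col') ,
          map (raiseWord never true) λs') ,
      mkIsLC (Insertion.IntoCycle.cycle-valid A' σ' col' (perm-part v') z e)
          (raised-valid true A' λs' (lists-part v') never true (λ ()) (λ { (_ , _ , ()) }) (λ ()))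
    join-at A' σ' col' λs' v' z false e =
      ((false ∷ A' , insertIntoPerm zero never σ' , nothing ∷ col') , map (raiseWord (λ x → does (x ≟F z)) false) λs') ,
      mkIsLC (Insertion.fixed-valid A' σ' col' (perm-part v') false nothing (λ ()) (λ _ → refl))
           (raised-valid false A' λs' (lists-part v') (λ x → does (x ≟F z)) false
               (λ {x} {y} tx ty → trans (dTrue x z tx) (sym (dTrue y z ty)))
             (λ _ → refl) (λ _ → z , Equivalence.from (l-cov (lists-part v') z) (⇒∉ e) , dEq z))

    lc-join : Carrier (LCStep n k c) → LCC (suc n) k c
    lc-join (inj₁ x) = join-prev k x
    lc-join (inj₂ ((((A' , σ' , col') , λs') , v') , inj₁ i)) =
      ((true ∷ A' , insertIntoPerm zero never σ' , just i ∷ col') , map (raiseWord never true) λs') ,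
      mkIsLC (Insertion.fixed-valid A' σ' col' (perm-part v') true (just i) (λ _ → i , refl) (λ ()))
           (raised-valid true A' λs' (lists-part v') never true (λ ()) (λ { (_ , _ , ()) }) (λ ()))
    lc-join (inj₂ ((((A' , σ' , col') , λs') , v') , inj₂ (inj₁ z))) = join-at A' σ' col' λs' v' z (lookup A' z) refl
    lc-join (inj₂ ((((A' , σ' , col') , λs') , v') , inj₂ (inj₂ j))) =
      ((false ∷ A' , insertIntoPerm zero never σ' , nothing ∷ col') , map (raiseWord (λ x → does (x ≟F hj)) true) λs') ,
      mkIsLC (Insertion.fixed-valid A' σ' col' (perm-part v') false nothing (λ ()) (λ _ → refl))
           (raised-valid false A' λs' (lists-part v') (λ x → does (x ≟F hj)) true
               (λ {x} {y} tx ty → trans (dTrue x hj tx) (sym (dTrue y hj ty)))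
             (λ _ → refl) (λ _ → hj , headIn λs' (lists-part v') j , dEq hj))
      where hj = unrank (heads λs') (cast (sym (count-heads λs' (lists-part v'))) j)

module LCStepCongruence where

  open Recurrence
  open WordSurgery
  open WordFacts
  open ColouredPermutations
  open ListSystems
  open Heads
  open ReinsertionLaws
  open ZeroMarkers
  open LCDecomposition
  open LCStepMaps
  open Search

  mkPrevLC-cong : ∀ {n c k1 k2} kk (e : kk ≡ suc k1) (e' : kk ≡ suc k2) (x : LCC n k1 c) (x' : LCC n k2 c) →
    Setoid._≈_ (LCRawSetoid n c) (proj₁ x) (proj₁ x') →
    Setoid._≈_ (Prev (λ k' → LC n k' c) kk) (mkPrevLC kk e x) (mkPrevLC kk e' x')
  mkPrevLC-cong .(suc _) refl refl x x' h = h

  unrank-cong : ∀ {n k} (S S' : Vec Bool n) → S ≡ S' → (j : Fin k) .(e : k ≡ count S) .(e' : k ≡ count S') →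
      unrank S (cast e j) ≡ unrank S' (cast e' j)
  unrank-cong S .S refl j e e' = refl

  module _ {n k c : ℕ} where

    split-offA-cong : ∀ A' s0 σt c0 colt λs λs'' → λs ↭ λs'' → ∀ v w b eb b' eb' u eu u' eu' h eh h' eh' →
        b ≡ b' → u ≡ u' → h ≡ h' →
      Setoid._≈_ (LCStep n k c) (split-offA A' s0 σt c0 colt λs v b eb u eu h eh)
          (split-offA A' s0 σt c0 colt λs'' w b' eb' u' eu' h' eh')
    split-offA-cong A' s0 σt c0 colt λs λs'' p v w true eb .true eb' u eu .u eu' h eh .h eh' refl refl refl =
      inj₁ (mkPrevLC-cong k _ _ _ _ (refl , lowerSystem-↭ p))
    split-offA-cong A' s0 σt c0 colt λs λs'' p v w false eb .false eb'
        (just y) eu .(just y) eu' h eh .h eh' refl refl refl =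
      inj₂ ((refl , lowerSystem-↭ p) , refl)
    split-offA-cong A' s0 σt c0 colt λs λs'' p v w false eb .false eb' nothing eu .nothing eu'
        (just h) eh .(just h) eh' refl refl refl =
      inj₂ ((refl , lowerSystem-↭ p) ,
          cong (λ z → inj₂ (inj₂ z))
          (cast-rank (heads (lowerSystem λs)) (heads (lowerSystem λs'')) (heads-↭ (lowerSystem-↭ p)) h _ _ _ _))
    split-offA-cong A' s0 σt c0 colt λs λs'' p v w false eb .false eb' nothing eu .nothing eu' nothing eh .nothing
        eh' refl refl refl =
      ⊥-elim (noneCase λs (lists-part v) eb eu eh)

    lc-split-cong : ∀ {x y} → Setoid._≈_ (LC (suc n) k c) x y → Setoid._≈_ (LCStep n k c) (lc-split x) (lc-split y)
    lc-split-cong {(((true ∷ A') , (zero ∷ σt) , (just i ∷ colt)) , λs) , v} {_ , w} (refl , p) =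
        inj₂ ((refl , lowerSystem-↭ p) , refl)
    lc-split-cong {(((true ∷ A') , (zero ∷ σt) , (nothing ∷ colt)) , λs) , v} {_ , w} (refl , p) with c-on
        (perm-part v) zero here
    ... | i , ()
    lc-split-cong {(((true ∷ A') , (suc z ∷ σt) , (c0 ∷ colt)) , λs) , v} {_ , w} (refl , p) =
        inj₂ ((refl , lowerSystem-↭ p) , refl)
    lc-split-cong {(((false ∷ A') , (s0 ∷ σt) , (c0 ∷ colt)) , λs) , v} {(_ , λs'') , w} (refl , p) =
      split-offA-cong A' s0 σt c0 colt λs λs'' p v w _ refl _ refl _ refl _ refl _ refl _ refl
        (hasSingletonZero-↭ p) (first-cong _ _ (zeroAfter-↭ p)) (first-cong _ _ (zeroBefore-↭ p))

    join-at-cong : ∀ A' σ' col' λs' λs'' → λs' ↭ λs'' → ∀ v w z b e →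
        Setoid._≈_ (LC (suc n) k c) (join-at A' σ' col' λs' v z b e) (join-at A' σ' col' λs'' w z b e)
    join-at-cong A' σ' col' λs' λs'' p v w z true e = refl , map⁺ _ p
    join-at-cong A' σ' col' λs' λs'' p v w z false e = refl , map⁺ _ p

    lc-join-cong : ∀ {x y} → Setoid._≈_ (LCStep n k c) x y → Setoid._≈_ (LC (suc n) k c) (lc-join x) (lc-join y)
    lc-join-cong {inj₁ x} {inj₁ y} (inj₁ r) = go k x y r
      where
      go : ∀ kk x y → Setoid._≈_ (Prev (λ k' → LC n k' c) kk) x y →
          Setoid._≈_ (LC (suc n) kk c) (join-prev {n} {k} {c} kk x) (join-prev {n} {k} {c} kk y)
      go zero () y r
      go (suc k') x y (refl , p) = refl , ↭-prep _ (map⁺ _ p)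
    lc-join-cong {inj₂ (((t , λs') , v') , inj₁ i)} {inj₂ (((t , λs'') , w') , inj₁ .i)}
        (inj₂ ((refl , p) , refl)) = refl , map⁺ _ p
    lc-join-cong {inj₂ ((((A' , σ' , col') , λs') , v') , inj₂ (inj₁ z))} {inj₂ (((_ , λs'') , w') , _)}
        (inj₂ ((refl , p) , refl)) =
      join-at-cong A' σ' col' λs' λs'' p v' w' z (lookup A' z) refl
    lc-join-cong {inj₂ ((((A' , σ' , col') , λs') , v') , inj₂ (inj₂ j))} {inj₂ (((_ , λs'') , w') , _)}
        (inj₂ ((refl , p) , refl)) =
      refl , ↭-trans (map⁺ _ p) (↭-reflexive (cong (λ h → map (raiseWord (λ x → does (x ≟F h)) true) λs'')
        (unrank-cong (heads λs') (heads λs'') (heads-↭ p) j _ _)))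

module LCStepLeftInverse where

  open Recurrence
  open WordSurgery
  open WordFacts
  open ColouredPermutations
  open ListSystems
  open Heads
  open ReinsertionLaws
  open ZeroMarkers
  open LCDecomposition
  open LCStepMaps
  open LCStepCongruence
  open Search

  mkPrevLC-raw : ∀ {n c k1} k0 (e : suc k0 ≡ suc k1) (x : LCC n k1 c) → proj₁ (mkPrevLC {n} {c} (suc k0) e x) ≡ proj₁ x
  mkPrevLC-raw k0 refl x = refl

  rawEq : ∀ {n c} {x y : LCRaw n c} → x ≡ y → Setoid._≈_ (LCRawSetoid n c) x y
  rawEq refl = refl , ↭-refl

  module _ {n k c : ℕ} where
    StepS = LCStep n k c

    to∘from-prev : ∀ kk (x : Carrier (Prev (λ k' → LC n k' c) kk)) →
        Setoid._≈_ (LCStep n kk c) (lc-split (lc-join {n} {kk} {c} (inj₁ x))) (inj₁ x)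
    to∘from-prev zero ()
    to∘from-prev (suc k') ((((A' , σ' , col') , λs') , v') ) =
        go (hasSingletonZero λs) refl (first (zeroAfter λs)) refl (first (zeroBefore λs)) refl
        (hasSingletonZero-prev (map (raiseWord never true) λs'))
      where
      λs = (zero ∷ []) ∷ map (raiseWord never true) λs'
      V = proj₂ (join-prev {n} {suc k'} {c} (suc k') (((A' , σ' , col') , λs') , v'))
      go : ∀ b eb u eu w ew → b ≡ true →
           Setoid._≈_ (LCStep n (suc k') c)
               (split-offA A' zero (tabulate (bodyσ never σ')) nothing col' λs V b eb u eu w ew)
               (inj₁ (((A' , σ' , col') , λs') , v'))
      go true eb u eu w ew refl =
          inj₁ (Setoid.trans (LCRawSetoid n c)
          (rawEq (mkPrevLC-raw k' (sym (singleton-length′ λs (lists-part V) (decP (singletonZero? λs) eb)))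
          (((A' , removeFromPerm zero (tabulate (bodyσ never σ')) , col') , lowerSystem λs) ,
          mkIsLC (Removal.removed-valid false A' zero (tabulate (bodyσ never σ')) nothing col' (perm-part V))
          (LowerSystemValid.lowered-valid′ false A' λs (lists-part V)))))
           (cong (λ s → (A' , s , col')) (remove-insertIntoPerm zero never σ' (λ y ())) ,
               ↭-reflexive (lower∘raise never true λs' (l-ne (lists-part v')))))

    to∘from-at : ∀ (x : LCC n k c) z → Setoid._≈_ StepS (lc-split (lc-join (inj₂ (x , inj₂ (inj₁ z))))) (inj₂ (x , inj₂ (inj₁ z)))
    to∘from-at (((A' , σ' , col') , λs') , v') z = zc (lookup A' z) refl
      where
      zc : ∀ b e → Setoid._≈_ StepS (lc-split (join-at A' σ' col' λs' v' z b e))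
          (inj₂ ((((A' , σ' , col') , λs') , v') , inj₂ (inj₁ z)))
      zc true e = inj₂ ((cong (λ s → (A' , s , col'))
          (remove-insertIntoPerm (suc z) _ σ' (λ y ty → sym (dTrue (lookup σ' y) z ty))) ,
                        ↭-reflexive (lower∘raise never true λs' (l-ne (lists-part v')))) , refl)
      zc false e = go (hasSingletonZero λs) refl (first (zeroAfter λs)) refl (first (zeroBefore λs)) refl
          (hasSingletonZero-raise t false λs' (l-ne (lists-part v'))) (zeroAfter-raise z λs' zC)
        where
        t = λ x → does (x ≟F z)
        λs = map (raiseWord t false) λs'
        zC = Equivalence.from (l-cov (lists-part v') z) (⇒∉ e)
        V = proj₂ (join-at A' σ' col' λs' v' z false e)
        go : ∀ b eb u eu w ew → b ≡ false → u ≡ just z →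
             Setoid._≈_ StepS (split-offA A' zero (tabulate (bodyσ never σ')) nothing col' λs V b eb u eu w ew)
                 (inj₂ ((((A' , σ' , col') , λs') , v') , inj₂ (inj₁ z)))
        go false eb (just .z) eu w ew refl refl =
            inj₂ ((cong (λ s → (A' , s , col')) (remove-insertIntoPerm zero never σ' (λ y ())) ,
                        ↭-reflexive (lower∘raise t false λs' (l-ne (lists-part v')))) , refl)

    to∘from-head : ∀ (x : LCC n k c) j → Setoid._≈_ StepS (lc-split (lc-join (inj₂ (x , inj₂ (inj₂ j))))) (inj₂ (x , inj₂ (inj₂ j)))
    to∘from-head (((A' , σ' , col') , λs') , v') j =
      go (hasSingletonZero λs) refl (first (zeroAfter λs)) refl (first (zeroBefore λs)) refl
          (hasSingletonZero-raise t true λs' (l-ne (lists-part v')))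
          (FrontInsertion.zeroAfter-first λs' (lists-part v') hj hh) (FrontInsertion.zeroBefore-first λs' (lists-part v') hj hh)
      where
      cH' = count-heads λs' (lists-part v')
      hj = unrank (heads λs') (cast (sym cH') j)
      hj∈ = unrank∈ (heads λs') (cast (sym cH') j)
      hh : Any (Head hj) λs'
      hh = decP (any? (head? hj) λs') (trans (sym (heads-lookup λs' hj)) hj∈)
      t = λ x → does (x ≟F hj)
      λs = map (raiseWord t true) λs'
      V = proj₂ (lc-join {n} {k} {c} (inj₂ ((((A' , σ' , col') , λs') , v') , inj₂ (inj₂ j))))
      dm : lowerSystem λs ≡ λs'
      dm = lower∘raise t true λs' (l-ne (lists-part v'))
      go : ∀ b eb u eu w ew → b ≡ false → u ≡ nothing → w ≡ just hj →
           Setoid._≈_ StepS (split-offA A' zero (tabulate (bodyσ never σ')) nothing col' λs V b eb u eu w ew)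
               (inj₂ ((((A' , σ' , col') , λs') , v') , inj₂ (inj₂ j)))
      go false eb nothing eu (just .hj) ew refl refl refl =
        inj₂ ((cong (λ s → (A' , s , col')) (remove-insertIntoPerm zero never σ' (λ y ())) , ↭-reflexive dm) ,
          cong (λ q → inj₂ (inj₂ q))
            (trans (cast-rank (heads (lowerSystem λs)) (heads λs') (cong heads dm) hj _ hj∈ _ cH')
            (trans (cong (cast cH') (rank-unrank (heads λs') (cast (sym cH') j) hj∈)) (cast-inv (sym cH') cH' j))))

    lc-to∘from : ∀ y → Setoid._≈_ StepS (lc-split (lc-join y)) y
    lc-to∘from (inj₁ x) = to∘from-prev k x
    lc-to∘from (inj₂ ((((A' , σ' , col') , λs') , v') , inj₁ i)) =
      inj₂ ((cong (λ s → (A' , s , col')) (remove-insertIntoPerm zero never σ' (λ y ())) ,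
          ↭-reflexive (lower∘raise never true λs' (l-ne (lists-part v')))) , refl)
    lc-to∘from (inj₂ (x , inj₂ (inj₁ z))) = to∘from-at x z
    lc-to∘from (inj₂ (x , inj₂ (inj₂ j))) = to∘from-head x j

module LCStepRightInverse where

  open Recurrence
  open WordSurgery
  open WordFacts
  open ColouredPermutations
  open ListSystems
  open Heads
  open ReinsertionLaws
  open ZeroMarkers
  open LCDecomposition
  open LCStepMaps
  open LCStepCongruence
  open LCStepLeftInverse
  open Search

  singLaw′ : ∀ {n} (λs : List (List (Fin (suc n)))) → All (λ w → w ≢ []) λs → Unique (concat λs) → (zero ∷ []) ∈ₗ λs →
    ((zero ∷ []) ∷ map (raiseWord never true) (lowerSystem λs)) ↭ λs
  singLaw′ λs ne uq m with ∈-∃++ m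
  ... | pre , post , refl = singLaw pre post ne uq

  afterLaw′ : ∀ {n k} {A : Subset (suc n)} (λs : List (List (Fin (suc n)))) → IsListSystem (suc n) k A λs →
      ∀ {y} → first (zeroAfter λs) ≡ just y →
    map (raiseWord (λ x → does (x ≟F y)) false) (lowerSystem λs) ≡ λs
  afterLaw′ λs ll {y} e with afterFacts λs e
  ... | pre , post , u , v , refl = midLaw (λ x → does (x ≟F y)) false y (suc y ∷ zero ∷ []) pre u v post refl
          (cong (λ b → raiseLetter b false y []) (dEq y)) (λ x tx → dTrue x y tx) (there (here refl)) (here refl)
              (l-ne ll) (l-uq ll)

  afterIn : ∀ {n} (λs : List (List (Fin (suc n)))) → ∀ {y} → first (zeroAfter λs) ≡ just y → suc y ∈ₗ concat λs
  afterIn λs e with afterFacts λs e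
  ... | pre , post , u , v , refl = ∈-concat⁺′ (∈-++⁺ʳ u (here refl)) (∈-++⁺ʳ pre (here refl))

  headLaw′ : ∀ {n k} {A' : Subset n} (λs : List (List (Fin (suc n)))) → IsListSystem (suc n) k (false ∷ A') λs →
      first (zeroAfter λs) ≡ nothing →
    ∀ {h} → first (zeroBefore λs) ≡ just h → map (raiseWord (λ x → does (x ≟F h)) true) (lowerSystem λs) ≡ λs
  headLaw′ λs ll e2 {h} e3 with headFacts λs ll e2 e3
  ... | pre , post , r , refl = midLaw (λ x → does (x ≟F h)) true h (zero ∷ suc h ∷ []) pre [] r post refl
          (cong (λ b → raiseLetter b true h []) (dEq h)) (λ x tx → dTrue x h tx) (here refl) (there (here refl))
              (l-ne ll) (l-uq ll)

  join-prev-mkPrevLC : ∀ {n k c k1} kk (e : kk ≡ suc k1) (x : LCC n k1 c) →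
    proj₁ (join-prev {n} {k} {c} kk (mkPrevLC kk e x)) ≡
    ((false ∷ proj₁ (proj₁ (proj₁ x)) , insertIntoPerm zero never (proj₁ (proj₂ (proj₁ (proj₁ x)))) ,
        nothing ∷ proj₂ (proj₂ (proj₁ (proj₁ x)))) ,
     (zero ∷ []) ∷ map (raiseWord never true) (proj₂ (proj₁ x)))
  join-prev-mkPrevLC .(suc _) refl x = refl

  module _ {n k c : ℕ} where
    RawS = LCRawSetoid (suc n) c

    from∘to-offA : ∀ A' s0 σt c0 colt λs (v : IsLC (suc n) k c (((false ∷ A') , (s0 ∷ σt) , (c0 ∷ colt)) , λs)) →
      Setoid._≈_ RawS (proj₁ (lc-join {n} {k} {c} (lc-split ((((false ∷ A') , (s0 ∷ σt) , (c0 ∷ colt)) , λs) , v))))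
                     ((false ∷ A' , s0 ∷ σt , c0 ∷ colt) , λs)
    from∘to-offA A' s0 σt c0 colt λs v =
        go (hasSingletonZero λs) refl (first (zeroAfter λs)) refl (first (zeroBefore λs)) refl
      where
      ll = lists-part v
      cp = perm-part v
      s0z : s0 ≡ zero
      s0z = Removal.s0-off false A' s0 σt c0 colt cp refl
      c0n : c0 ≡ nothing
      c0n = c-off cp zero (λ m → false≢true (∈⇒ m))
      δ = removeFromPerm s0 σt
      tri : (false ∷ A' , insertIntoPerm zero never δ , nothing ∷ colt) ≡ (false ∷ A' , s0 ∷ σt , c0 ∷ colt)
      tri = cong₂ (λ a b → (false ∷ A' , a , b ∷ colt))
          (cong₂ _∷_ (sym s0z) (RemovalLaws.insert-remove-fixed false A' s0 σt c0 colt cp s0z)) (sym c0n)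
      go : ∀ b eb u eu w ew → Setoid._≈_ RawS
          (proj₁ (lc-join {n} {k} {c} (split-offA A' s0 σt c0 colt λs v b eb u eu w ew)))
          ((false ∷ A' , s0 ∷ σt , c0 ∷ colt) , λs)
      go true eb u eu w ew = Setoid.trans RawS (rawEq (join-prev-mkPrevLC {k = k} k _ _))
        (tri , singLaw′ λs (l-ne ll) (l-uq ll) (decP (singletonZero? λs) eb))
      go false eb (just y) eu w ew = zc _ (lookup A' y) refl yF
        where
        yF : lookup A' y ≡ false
        yF = ∉⇒ (λ m → Equivalence.to (l-cov ll (suc y)) (afterIn λs eu) (there m))
        zc : ∀ V b e → b ≡ false →
            Setoid._≈_ RawS (proj₁ (join-at {n} {k} {c} A' δ colt (lowerSystem λs) V y b e))
            ((false ∷ A' , s0 ∷ σt , c0 ∷ colt) , λs)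
        zc V false e refl = tri , ↭-reflexive (afterLaw′ λs ll eu)
      go false eb nothing eu (just h) ew =
        tri , ↭-reflexive (trans (cong (λ q → map (raiseWord (λ x → does (x ≟F q)) true) (lowerSystem λs)) hjh)
            (headLaw′ λs ll eu ew))
        where
        ns : (zero ∷ []) ∉ₗ λs
        ns m = false≢true (trans (sym eb) (dec-true (singletonZero? λs) m))
        ll' = LowerSystemValid.lowered-valid false A' λs ll ns
        cH = count-heads (lowerSystem λs) ll'
        pr = headPr λs ll eu ew
        hjh : unrank (heads (lowerSystem λs)) (cast (sym cH) (cast cH (rank (heads (lowerSystem λs)) h pr))) ≡ h
        hjh = trans (cong (unrank (heads (lowerSystem λs))) (cast-inv cH (sym cH) _))
            (unrank-rank (heads (lowerSystem λs)) h pr)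
      go false eb nothing eu nothing ew = ⊥-elim (noneCase λs ll eb eu ew)

    lc-from∘to : ∀ x → Setoid._≈_ RawS (proj₁ (lc-join {n} {k} {c} (lc-split x))) (proj₁ x)
    lc-from∘to ((((true ∷ A') , (zero ∷ σt) , (just i ∷ colt)) , λs) , v) =
      cong (λ s → (true ∷ A' , zero ∷ s , just i ∷ colt))
          (RemovalLaws.insert-remove-fixed true A' zero σt (just i) colt (perm-part v) refl) ,
      ↭-reflexive (trueLaw λs (l-ne (lists-part v)) (λ m → Equivalence.to (l-cov (lists-part v) zero) m here))
    lc-from∘to ((((true ∷ A') , (zero ∷ σt) , (nothing ∷ colt)) , λs) , v) with c-on (perm-part v) zero here
    ... | i , ()
    lc-from∘to ((((true ∷ A') , (suc z ∷ σt) , (c0 ∷ colt)) , λs) , v) =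
        go (lookup A' z) refl (Removal.s0-in true A' (suc z) σt c0 colt (perm-part v) z refl)
      where
      δ = removeFromPerm (suc z) σt
      go : ∀ b e → b ≡ true → Setoid._≈_ RawS
          (proj₁ (join-at {n} {k} {c} A' δ colt (lowerSystem λs) (remove-valid A' (suc z) σt c0 colt λs v) z b e))
          ((true ∷ A' , suc z ∷ σt , c0 ∷ colt) , λs)
      go true e refl = cong₂ (λ s c' → (true ∷ A' , suc z ∷ s , c' ∷ colt))
          (RemovalLaws.insert-remove-cycle true A' (suc z) σt c0 colt (perm-part v) z refl) (c-cyc (perm-part v) zero) ,
        ↭-reflexive (trueLaw λs (l-ne (lists-part v)) (λ m → Equivalence.to (l-cov (lists-part v) zero) m here))
    lc-from∘to ((((false ∷ A') , (s0 ∷ σt) , (c0 ∷ colt)) , λs) , v) = from∘to-offA A' s0 σt c0 colt λs v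

module LCCount where

  open Recurrence
  open LCDecomposition
  open LCStepMaps
  open LCStepCongruence
  open LCStepLeftInverse
  open LCStepRightInverse

  lc-step : ∀ c n k → LC (suc n) k c ≅ Step (λ n k → c + n + k) (λ n k → LC n k c) n k
  lc-step c n k = mk-iso {S = LC (suc n) k c} {T = LCStep n k c} lc-split lc-join lc-split-cong lc-join-cong
      lc-to∘from lc-from∘to
                 ⊙ (id-iso ⊎-inverse (id-iso ×-inverse LC-choices-iso c n k))

  lc-base : ∀ c k → LC 0 k c ≅ Canon c 0 k
  lc-base c zero = mk-iso {S = LC 0 0 c} {T = Canon c 0 0} (λ _ → tt) (λ _ → e) (λ _ → refl) (λ _ → refl , ↭-refl)
    (λ { tt → refl }) law
    where
    e : LCC 0 0 c
    e = ((([] , [] , []) , []) , isLC (λ ()) (λ ()) (λ ()) (λ ()) (λ ()) refl [] [] (λ ()))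
    law : ∀ x → Setoid._≈_ (LC 0 0 c) e x
    law ((([] , [] , []) , []) , v) = refl , ↭-refl
    law ((([] , [] , []) , (w ∷ ws)) , v) with IsLC.λ-count v
    ... | ()
  lc-base c (suc k) = empty-iso {S = LC 0 (suc k) c} {T = Canon c 0 (suc k)} f (λ ())
    where
    f : LCC 0 (suc k) c → ⊥
    f ((([] , [] , []) , []) , v) with IsLC.λ-count v
    ... | ()
    f ((([] , [] , []) , ([] ∷ ws)) , v) with IsLC.λ-nonempty v
    ... | p ∷ _ = p refl
    f ((([] , [] , []) , ((() ∷ w) ∷ ws)) , v)

  lc-canon : ∀ c n k → LC n k c ≅ Canon c n k
  lc-canon c = recurrence-iso (λ n k → c + n + k) (λ n k → LC n k c) (Canon c) (lc-step c) (canon-step c) (lc-base c)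

-- For α = -1
-- there are no colours and n ≥ 1 is needed to write the right side as K_{n,n-1}.
open Recurrence
open Matchings
open MatchingCount
open LCCount

proposition3 : (n k : ℕ) (α : ℤ) → 1 ≤ n → 1 ≤ k → -1ℤ ≤ℤ α →
    Bijection (LCSetoid n k α) (MatchSetoid n k α)
proposition3 n k (ℤ.+ d) _ _ _ =
  Inverse⇒Bijection (lc-canon (suc d) n k ⊙ sym-iso (pinj-canon d n k) ⊙ sym-iso matchings≅pinj)
proposition3 (suc n) k ℤ.-[1+ 0 ] _ _ _ =
  Inverse⇒Bijection (lc-canon 0 (suc n) k ⊙ sym-iso (pinj-canon₋₁ n k) ⊙ sym-iso matchings≅pinj)
proposition3 zero k ℤ.-[1+ 0 ] () _ _
proposition3 n k ℤ.-[1+ suc m ] _ _ (ℤ.-≤- ())
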